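{- Let $p$ be an odd prime and $r\ge3$ an integer with $p\nmid r$. For $i\in\{1,\dots,n\}$ let $V_i=\mathbb{Z}_p^{d_i}$, and let $G=(V_1\times\cdots\times V_n)\rtimes_{(\psi_1,\dots,\psi_n)}\mathrm{D}_{2r}$ where each $\psi_i:\mathrm{D}_{2r}\to\mathrm{GL}(V_i)$ is irreducible. If $G$ has a rotary pair $(\rho,\tau)$ with $|\rho|=2p$ and $|\tau|=2$, then $\psi_i\not\cong\psi_j$ for all $1\le i<j\le n$.
   Context: A rotary pair of $G$ is $(\rho,\tau)\in G\times G$ with $G=\langle\rho,\tau\rangle$ and $|\tau|=2$. $\mathrm{D}_{2r}$ is the dihedral group of order $2r$ acting on $\prod_iV_i$ (with $V_i=\mathbb{F}_p^{d_i}$) componentwise via the $\psi_i$. -}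

module Defs where

open import Data.Nat as ℕ using (ℕ; zero; suc; NonZero; _<_)
open import Data.Nat.DivMod using (_mod_)
open import Data.Fin as Fin using (Fin; toℕ; zero; suc)
open import Data.Vec using (Vec; tabulate; lookup; replicate)
open import Data.List using (List; []; _∷_; foldr)
open import Data.Bool using (Bool; true; false; not)
open import Data.Product using (Σ; _×_; _,_)
open import Data.Sum using (_⊎_)
open import Relation.Binary.PropositionalEquality using (_≡_)
open import Relation.Nullary using (¬_)

module _ (p : ℕ) {{_ : NonZero p}} where

  _+F_ : Fin p → Fin p → Fin p
  a +F b = (toℕ a ℕ.+ toℕ b) mod p

  _*F_ : Fin p → Fin p → Fin p
  a *F b = (toℕ a ℕ.* toℕ b) mod p

  -F_ : Fin p → Fin p
  -F a = (p ℕ.∸ toℕ a) mod p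

  0F : Fin p
  0F = 0 mod p

  Vect : ℕ → Set
  Vect d = Vec (Fin p) d

  vzero : ∀ {d} → Vect d
  vzero = replicate _ 0F

  vadd : ∀ {d} → Vect d → Vect d → Vect d
  vadd u v = tabulate λ i → lookup u i +F lookup v i

  vneg : ∀ {d} → Vect d → Vect d
  vneg u = tabulate λ i → -F lookup u i

  vscale : ∀ {d} → Fin p → Vect d → Vect d
  vscale c u = tabulate λ i → c *F lookup u i

  -- matrices with m rows and n columns (linear maps F_p^n → F_p^m)
  Mat : ℕ → ℕ → Set
  Mat m n = Fin m → Fin n → Fin p

  sumF : ∀ {n} → (Fin n → Fin p) → Fin p
  sumF {zero} f = 0F
  sumF {suc n} f = f zero +F sumF (λ i → f (suc i))

  apply : ∀ {m n} → Mat m n → Vect n → Vect m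
  apply M v = tabulate λ i → sumF λ j → M i j *F lookup v j

-- The dihedral group D_{2r} = ⟨x, y | x^r, y^2, (xy)^2⟩; the element
-- (a , s) stands for x^a y^s (s = true meaning one factor y).

module _ (r : ℕ) {{_ : NonZero r}} where

  Dih : Set
  Dih = Fin r × Bool

  dmul : Dih → Dih → Dih
  dmul (a , false) (b , t) = ((toℕ a ℕ.+ toℕ b) mod r) , t
  dmul (a , true)  (b , t) = ((toℕ a ℕ.+ (r ℕ.∸ toℕ b)) mod r) , not t

  dinv : Dih → Dih
  dinv (a , false) = ((r ℕ.∸ toℕ a) mod r) , false
  dinv (a , true)  = a , true

  de : Dih
  de = (0 mod r) , false

module _ (p : ℕ) {{_ : NonZero p}} (r : ℕ) {{_ : NonZero r}} where

  -- a group homomorphism D_{2r} → GL(F_p^d) (invertibility of the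
  -- images follows from ψ(e) = id and multiplicativity)
  record Rep (d : ℕ) : Set where
    field
      ψ     : Dih r → Mat p d d
      ψ-e   : ∀ v → apply p (ψ (de r)) v ≡ v
      ψ-mul : ∀ g h v → apply p (ψ (dmul r g h)) v ≡ apply p (ψ g) (apply p (ψ h) v)
  open Rep public

  InvariantSubspace : ∀ {d} → Rep d → (Vect p d → Set) → Set
  InvariantSubspace ψs W =
    W (vzero p)
    × (∀ u v → W u → W v → W (vadd p u v))
    × (∀ c v → W v → W (vscale p c v))
    × (∀ g v → W v → W (apply p (ψ ψs g) v))

  Irreducible : ∀ {d} → Rep d → Set₁
  Irreducible {d} ψs =
    Σ (Vect p d) (λ v → ¬ v ≡ vzero p)
    × (∀ W → InvariantSubspace ψs W →
         (∀ v → W v → v ≡ vzero p) ⊎ (∀ v → W v))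

  RepIso : ∀ {d₁ d₂} → Rep d₁ → Rep d₂ → Set
  RepIso {d₁} {d₂} ψ₁ ψ₂ =
    Σ (Mat p d₂ d₁) λ P → Σ (Mat p d₁ d₂) λ Q →
      (∀ v → apply p Q (apply p P v) ≡ v)
      × (∀ w → apply p P (apply p Q w) ≡ w)
      × (∀ g v → apply p P (apply p (ψ ψ₁ g) v) ≡ apply p (ψ ψ₂ g) (apply p P v))

  module _ (n : ℕ) (d : Fin n → ℕ) (ψs : (i : Fin n) → Rep (d i)) where

    SD : Set
    SD = ((i : Fin n) → Vect p (d i)) × Dih r

    smul : SD → SD → SD
    smul (v , g) (w , h) =
      (λ i → vadd p (v i) (apply p (ψ (ψs i) g) (w i))) , dmul r g h

    sinv : SD → SD
    sinv (v , g) = (λ i → vneg p (apply p (ψ (ψs i) (dinv r g)) (v i))) , dinv r g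

    se : SD
    se = (λ i → vzero p) , de r

    _≈_ : SD → SD → Set
    (v , g) ≈ (w , h) = (∀ i → v i ≡ w i) × g ≡ h

    spow : SD → ℕ → SD
    spow x zero = se
    spow x (suc k) = smul x (spow x k)

    HasOrder : SD → ℕ → Set
    HasOrder x m = spow x m ≈ se × (∀ k → 0 < k → k < m → ¬ spow x k ≈ se)

    data Letter : Set where
      ρ⁺ ρ⁻ τ⁺ τ⁻ : Letter

    evalWord : SD → SD → List Letter → SD
    evalWord ρ τ = foldr (λ l acc → smul (letter l) acc) se
      where
      letter : Letter → SD
      letter ρ⁺ = ρ
      letter ρ⁻ = sinv ρ
      letter τ⁺ = τ
      letter τ⁻ = sinv τ

    Generates : SD → SD → Set
    Generates ρ τ = ∀ x → Σ (List Letter) λ w → evalWord ρ τ w ≈ x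

    RotaryPair : SD → SD → Set
    RotaryPair ρ τ = Generates ρ τ × HasOrder τ 2

module Submission where

-- If ρ were a rotation, the dihedral parts of ρ and τ would lie in the subgroup of rotations or,
-- since |ρ| = 2p with p ∤ r leaves ρ a rotation of order at most 2, in a proper subgroup
-- {x^z | 2z = 0} ∪ {x^z y | 2z = 2c}; likewise for τ. So ρ = (v , g) and τ = (w , h) with g, h
-- reflections (the order of ρ plays no further role). Suppose ψ_i ≅ ψ_j with i ≠ j and read the
-- j-th coordinate in V = V_i through the isomorphism. We exhibit a property of the triples
-- (c_i , c_j , k) that holds at 1 and is preserved by left multiplication with ρ, ρ⁻¹ and τ, but
-- fails at (y , 0 , 1) or (0 , y , 1) for y ≠ 0. The vectors fixed by X = ψ(gh) form a
-- subrepresentation of the irreducible V, so either X is fixed-point free or X = 1.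
--  • X fixed-point free: the pair of "defects" (1 − X) c − (1 − k) t, with ρτ = (t , gh), stays in
--    the ⟨X⟩-module generated by the pair (u₂ , u₂′) of translation parts of ρ². Its elements
--    are (φ u₂ , φ u₂′) with φ commuting with X, and by irreducibility φ u₂′ = 0 forces φ = 0 or
--    u₂′ = 0; so it never contains both (y − X y , 0) and (0 , y − X y) with y ≠ 0.
--  • X = 1: then H = G, and the G-even and G-odd parts of the two coordinates stay multiples, with
--    common scalars, of fixed pairs of vectors. Hence both parts of y vanish, and y = 0 as p is odd.

open import Defs renaming (_≈_ to _≈ˢ_)
open import Data.Nat using (ℕ; NonZero; _≤_; _*_)
open import Data.Nat.Divisibility using (_∣_)
open import Data.Nat.Primality using (Prime)
open import Data.Fin using (Fin) renaming (_<_ to _<ᶠ_)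
open import Relation.Binary.PropositionalEquality using (_≡_)
open import Relation.Nullary using (¬_; yes; no)

open import Algebra.Bundles using (Group; AbelianGroup; CommutativeRing)
open import Data.Bool using (true; false; not)
open import Data.Empty using (⊥; ⊥-elim)
open import Data.Fin as Fin using (toℕ; zero; suc)
open import Data.Fin.Properties using (toℕ-injective; toℕ-fromℕ<; toℕ<n; <⇒≢)
open import Data.Nat as ℕ using (zero; suc; _+_; _∸_; _%_)
import Data.Nat.Properties as ℕ
open import Data.Nat.Base using (nonTrivial⇒n>1)
open import Data.Nat.Divisibility using (∣⇒≤; n∣m⇒m%n≡0; m%n≡0⇒n∣m)
open import Data.Nat.Primality using (euclidsLemma; prime⇒nonTrivial; prime⇒irreducible)
open import Data.Nat.Coprimality using (Coprime; coprime-divisor)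
open import Data.Nat.DivMod using (_mod_; m%n<n; m<n⇒m%n≡m; %-distribˡ-+; %-distribˡ-*; n%n≡0; m%n%n≡m%n; m*n%n≡0)
open import Data.Product using (Σ; ∃; _×_; _,_; proj₁; proj₂)
open import Data.Sum as Sum using (_⊎_; inj₁; inj₂; [_,_]′)
open import Data.List using ([]; _∷_)
open import Data.Vec using (Vec; []; _∷_; lookup; replicate; zipWith; map)
open import Data.Vec.Properties using (tabulate∘lookup; tabulate-cong; lookup∘tabulate; lookup-replicate)
open import Function using (_∘_; id)
open import Level using (0ℓ)

module AbelianGroupSolver {c ℓ} (G : AbelianGroup c ℓ) where

  open AbelianGroup G
  open import Algebra.Properties.AbelianGroup G using (⁻¹-∙-comm; ⁻¹-anti-homo‿-; ε⁻¹≈ε; //-cong₂)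
  open import Algebra.Properties.CommutativeSemigroup commutativeSemigroup using (interchange)
  open import Algebra.Properties.Monoid.Mult monoid using (×-homo-+) renaming (_×_ to _·_)
  open import Relation.Binary.Reasoning.Setoid setoid

  infixl 6 _⊕_ _⊖_
  infix 8 ⊝_

  data Expr (n : ℕ) : Set where
    var : Fin n → Expr n
    ∅   : Expr n
    _⊕_ : Expr n → Expr n → Expr n
    ⊝_  : Expr n → Expr n

  _⊖_ : ∀ {n} → Expr n → Expr n → Expr n
  e ⊖ f = e ⊕ ⊝ f

  ⟦_⟧ : ∀ {n} → Expr n → Vec Carrier n → Carrier
  ⟦ var i ⟧ ρ = lookup ρ i
  ⟦ ∅ ⟧     ρ = ε
  ⟦ e ⊕ f ⟧ ρ = ⟦ e ⟧ ρ ∙ ⟦ f ⟧ ρ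
  ⟦ ⊝ e ⟧   ρ = ⟦ e ⟧ ρ ⁻¹

  -- A pair (k , l) stands for the coefficient k − l; after cancel one of k, l is 0, so two
  -- expressions that are equal in every abelian group have identical normal forms.
  Normal : ℕ → Set
  Normal n = Vec (ℕ × ℕ) n

  ⟦_⟧⇓ : ∀ {n} → Normal n → Vec Carrier n → Carrier
  ⟦ [] ⟧⇓          []      = ε
  ⟦ (k , l) ∷ v ⟧⇓ (x ∷ ρ) = (k · x - l · x) ∙ ⟦ v ⟧⇓ ρ

  zeros : ∀ {n} → Normal n
  zeros = replicate _ (0 , 0)

  unit : ∀ {n} → Fin n → Normal n
  unit zero    = (1 , 0) ∷ zeros
  unit (suc i) = (0 , 0) ∷ unit i

  plus : ∀ {n} → Normal n → Normal n → Normal n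
  plus = zipWith λ (k , l) (k′ , l′) → (k + k′ , l + l′)

  minus : ∀ {n} → Normal n → Normal n
  minus = map λ (k , l) → (l , k)

  cancel : ℕ × ℕ → ℕ × ℕ
  cancel (k , l) = (k ∸ l , l ∸ k)

  collect : ∀ {n} → Expr n → Normal n
  collect (var i) = unit i
  collect ∅       = zeros
  collect (e ⊕ f) = plus (collect e) (collect f)
  collect (⊝ e)   = minus (collect e)

  normalise : ∀ {n} → Expr n → Normal n
  normalise e = map cancel (collect e)

  -[]-interchange : ∀ a b c d → (a - b) ∙ (c - d) ≈ (a ∙ c) - (b ∙ d)
  -[]-interchange a b c d = trans (interchange a (b ⁻¹) c (d ⁻¹)) (∙-congˡ (⁻¹-∙-comm b d))

  zeros-correct : ∀ {n} (ρ : Vec Carrier n) → ⟦ zeros ⟧⇓ ρ ≈ ε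
  zeros-correct []      = refl
  zeros-correct (x ∷ ρ) = trans (∙-cong (inverseʳ ε) (zeros-correct ρ)) (identityˡ ε)

  unit-correct : ∀ {n} (i : Fin n) ρ → ⟦ unit i ⟧⇓ ρ ≈ lookup ρ i
  unit-correct zero (x ∷ ρ) = begin
    (x ∙ ε - ε) ∙ ⟦ zeros ⟧⇓ ρ ≈⟨ ∙-cong (∙-cong (identityʳ x) ε⁻¹≈ε) (zeros-correct ρ) ⟩
    (x ∙ ε) ∙ ε               ≈⟨ trans (identityʳ _) (identityʳ x) ⟩
    x                         ∎
  unit-correct (suc i) (x ∷ ρ) = trans (∙-cong (inverseʳ ε) (unit-correct i ρ)) (identityˡ _)

  plus-correct : ∀ {n} (v w : Normal n) ρ → ⟦ plus v w ⟧⇓ ρ ≈ ⟦ v ⟧⇓ ρ ∙ ⟦ w ⟧⇓ ρ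
  plus-correct []            []              []      = sym (identityˡ ε)
  plus-correct ((k , l) ∷ v) ((k′ , l′) ∷ w) (x ∷ ρ) = begin
    ((k + k′) · x - (l + l′) · x) ∙ ⟦ plus v w ⟧⇓ ρ
      ≈⟨ ∙-cong (//-cong₂ (×-homo-+ x k k′) (×-homo-+ x l l′)) (plus-correct v w ρ) ⟩
    (k · x ∙ k′ · x - (l · x ∙ l′ · x)) ∙ (⟦ v ⟧⇓ ρ ∙ ⟦ w ⟧⇓ ρ)
      ≈⟨ ∙-congʳ (-[]-interchange _ _ _ _) ⟨
    ((k · x - l · x) ∙ (k′ · x - l′ · x)) ∙ (⟦ v ⟧⇓ ρ ∙ ⟦ w ⟧⇓ ρ)
      ≈⟨ interchange _ _ _ _ ⟩
    ⟦ (k , l) ∷ v ⟧⇓ (x ∷ ρ) ∙ ⟦ (k′ , l′) ∷ w ⟧⇓ (x ∷ ρ) ∎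

  minus-correct : ∀ {n} (v : Normal n) ρ → ⟦ minus v ⟧⇓ ρ ≈ ⟦ v ⟧⇓ ρ ⁻¹
  minus-correct []            []      = sym ε⁻¹≈ε
  minus-correct ((k , l) ∷ v) (x ∷ ρ) = begin
    (l · x - k · x) ∙ ⟦ minus v ⟧⇓ ρ    ≈⟨ ∙-cong (sym (⁻¹-anti-homo‿- (k · x) (l · x))) (minus-correct v ρ) ⟩
    (k · x - l · x) ⁻¹ ∙ ⟦ v ⟧⇓ ρ ⁻¹    ≈⟨ ⁻¹-∙-comm _ _ ⟩
    ((k · x - l · x) ∙ ⟦ v ⟧⇓ ρ) ⁻¹     ∎

  cancel-correct : ∀ k l x → proj₁ (cancel (k , l)) · x - proj₂ (cancel (k , l)) · x ≈ k · x - l · x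
  cancel-correct zero    zero    x = refl
  cancel-correct zero    (suc l) x = refl
  cancel-correct (suc k) zero    x = refl
  cancel-correct (suc k) (suc l) x = begin
    (k ∸ l) · x - (l ∸ k) · x     ≈⟨ cancel-correct k l x ⟩
    k · x - l · x                 ≈⟨ identityˡ _ ⟨
    ε ∙ (k · x - l · x)           ≈⟨ ∙-congʳ (inverseʳ x) ⟨
    (x - x) ∙ (k · x - l · x)     ≈⟨ -[]-interchange x x (k · x) (l · x) ⟩
    (x ∙ k · x) - (x ∙ l · x)     ∎

  cancel-all-correct : ∀ {n} (v : Normal n) ρ → ⟦ map cancel v ⟧⇓ ρ ≈ ⟦ v ⟧⇓ ρ
  cancel-all-correct []            []      = refl
  cancel-all-correct ((k , l) ∷ v) (x ∷ ρ) = ∙-cong (cancel-correct k l x) (cancel-all-correct v ρ)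

  collect-correct : ∀ {n} (e : Expr n) ρ → ⟦ collect e ⟧⇓ ρ ≈ ⟦ e ⟧ ρ
  collect-correct (var i) ρ = unit-correct i ρ
  collect-correct ∅       ρ = zeros-correct ρ
  collect-correct (e ⊕ f) ρ = trans (plus-correct (collect e) (collect f) ρ) (∙-cong (collect-correct e ρ) (collect-correct f ρ))
  collect-correct (⊝ e)   ρ = trans (minus-correct (collect e) ρ) (⁻¹-cong (collect-correct e ρ))

  normalise-correct : ∀ {n} (e : Expr n) ρ → ⟦ normalise e ⟧⇓ ρ ≈ ⟦ e ⟧ ρ
  normalise-correct e ρ = trans (cancel-all-correct (collect e) ρ) (collect-correct e ρ)

  open import Relation.Binary.Reflection setoid var ⟦_⟧ (⟦_⟧⇓ ∘ normalise) normalise-correct public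
    using (solve; _⊜_)

open import Relation.Binary.PropositionalEquality using (refl; sym; trans; cong; cong₂; subst; subst₂; isEquivalence; module ≡-Reasoning)

module Modular (p : ℕ) {{_ : NonZero p}} where

  infixl 6 _+ₘ_
  infixl 7 _*ₘ_
  infix 8 -ₘ_

  _+ₘ_ _*ₘ_ : Fin p → Fin p → Fin p
  _+ₘ_ = _+F_ p
  _*ₘ_ = _*F_ p

  -ₘ_ : Fin p → Fin p
  -ₘ_ = -F_ p

  0ₘ 1ₘ : Fin p
  0ₘ = 0F p
  1ₘ = 1 mod p

  toℕ-mod : ∀ m → toℕ (m mod p) ≡ m % p
  toℕ-mod m = toℕ-fromℕ< (m%n<n m p)

  mod-cong : ∀ {m n} → m % p ≡ n % p → m mod p ≡ n mod p
  mod-cong {m} {n} eq = toℕ-injective (trans (toℕ-mod m) (trans eq (sym (toℕ-mod n))))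

  toℕ-0ₘ : toℕ 0ₘ ≡ 0
  toℕ-0ₘ = trans (toℕ-mod 0) (m*n%n≡0 0 p)

  toℕ-mod-inverse : ∀ (x : Fin p) → toℕ x mod p ≡ x
  toℕ-mod-inverse x = toℕ-injective (trans (toℕ-mod (toℕ x)) (m<n⇒m%n≡m (toℕ<n x)))

  mod-absorbˡ-+ : ∀ m n → (toℕ (m mod p) + n) % p ≡ (m + n) % p
  mod-absorbˡ-+ m n = begin
    (toℕ (m mod p) + n) % p     ≡⟨ cong (λ k → (k + n) % p) (toℕ-mod m) ⟩
    (m % p + n) % p             ≡⟨ %-distribˡ-+ (m % p) n p ⟩
    (m % p % p + n % p) % p     ≡⟨ cong (λ k → (k + n % p) % p) (m%n%n≡m%n m p) ⟩
    (m % p + n % p) % p         ≡⟨ %-distribˡ-+ m n p ⟨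
    (m + n) % p                 ∎
    where open ≡-Reasoning

  mod-absorbʳ-+ : ∀ m n → (m + toℕ (n mod p)) % p ≡ (m + n) % p
  mod-absorbʳ-+ m n = trans (cong (_% p) (ℕ.+-comm m _)) (trans (mod-absorbˡ-+ n m) (cong (_% p) (ℕ.+-comm n m)))

  mod-absorbˡ-* : ∀ m n → (toℕ (m mod p) ℕ.* n) % p ≡ (m ℕ.* n) % p
  mod-absorbˡ-* m n = begin
    (toℕ (m mod p) ℕ.* n) % p       ≡⟨ cong (λ k → (k ℕ.* n) % p) (toℕ-mod m) ⟩
    (m % p ℕ.* n) % p               ≡⟨ %-distribˡ-* (m % p) n p ⟩
    (m % p % p ℕ.* (n % p)) % p     ≡⟨ cong (λ k → (k ℕ.* (n % p)) % p) (m%n%n≡m%n m p) ⟩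
    (m % p ℕ.* (n % p)) % p         ≡⟨ %-distribˡ-* m n p ⟨
    (m ℕ.* n) % p                   ∎
    where open ≡-Reasoning

  mod-absorbʳ-* : ∀ m n → (m ℕ.* toℕ (n mod p)) % p ≡ (m ℕ.* n) % p
  mod-absorbʳ-* m n = trans (cong (_% p) (ℕ.*-comm m _)) (trans (mod-absorbˡ-* n m) (cong (_% p) (ℕ.*-comm n m)))

  +ₘ-assoc : ∀ x y z → (x +ₘ y) +ₘ z ≡ x +ₘ (y +ₘ z)
  +ₘ-assoc x y z = mod-cong (trans (mod-absorbˡ-+ _ _)
    (trans (cong (_% p) (ℕ.+-assoc (toℕ x) (toℕ y) (toℕ z))) (sym (mod-absorbʳ-+ (toℕ x) _))))

  +ₘ-comm : ∀ x y → x +ₘ y ≡ y +ₘ x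
  +ₘ-comm x y = cong (_mod p) (ℕ.+-comm (toℕ x) (toℕ y))

  +ₘ-identityˡ : ∀ x → 0ₘ +ₘ x ≡ x
  +ₘ-identityˡ x = trans (mod-cong (mod-absorbˡ-+ 0 (toℕ x))) (toℕ-mod-inverse x)

  -ₘ-inverseˡ : ∀ x → -ₘ x +ₘ x ≡ 0ₘ
  -ₘ-inverseˡ x = mod-cong (begin
    (toℕ ((p ∸ toℕ x) mod p) + toℕ x) % p   ≡⟨ mod-absorbˡ-+ (p ∸ toℕ x) (toℕ x) ⟩
    (p ∸ toℕ x + toℕ x) % p                  ≡⟨ cong (_% p) (ℕ.m∸n+n≡m (ℕ.<⇒≤ (toℕ<n x))) ⟩
    p % p                                    ≡⟨ n%n≡0 p ⟩
    0                                        ≡⟨ m*n%n≡0 0 p ⟨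
    0 % p                                    ∎)
    where open ≡-Reasoning

  *ₘ-assoc : ∀ x y z → (x *ₘ y) *ₘ z ≡ x *ₘ (y *ₘ z)
  *ₘ-assoc x y z = mod-cong (trans (mod-absorbˡ-* _ _)
    (trans (cong (_% p) (ℕ.*-assoc (toℕ x) (toℕ y) (toℕ z))) (sym (mod-absorbʳ-* (toℕ x) _))))

  *ₘ-comm : ∀ x y → x *ₘ y ≡ y *ₘ x
  *ₘ-comm x y = cong (_mod p) (ℕ.*-comm (toℕ x) (toℕ y))

  *ₘ-identityˡ : ∀ x → 1ₘ *ₘ x ≡ x
  *ₘ-identityˡ x = trans (mod-cong (trans (mod-absorbˡ-* 1 (toℕ x)) (cong (_% p) (ℕ.*-identityˡ (toℕ x))))) (toℕ-mod-inverse x)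

  *ₘ-distribˡ-+ₘ : ∀ x y z → x *ₘ (y +ₘ z) ≡ x *ₘ y +ₘ x *ₘ z
  *ₘ-distribˡ-+ₘ x y z = mod-cong (begin
    (toℕ x ℕ.* toℕ ((toℕ y + toℕ z) mod p)) % p           ≡⟨ mod-absorbʳ-* (toℕ x) _ ⟩
    (toℕ x ℕ.* (toℕ y + toℕ z)) % p                        ≡⟨ cong (_% p) (ℕ.*-distribˡ-+ (toℕ x) (toℕ y) (toℕ z)) ⟩
    (toℕ x ℕ.* toℕ y + toℕ x ℕ.* toℕ z) % p               ≡⟨ mod-absorbʳ-+ _ (toℕ x ℕ.* toℕ z) ⟨
    (toℕ x ℕ.* toℕ y + toℕ (x *ₘ z)) % p                  ≡⟨ mod-absorbˡ-+ (toℕ x ℕ.* toℕ y) _ ⟨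
    (toℕ (x *ₘ y) + toℕ (x *ₘ z)) % p                     ∎)
    where open ≡-Reasoning

  +ₘ-*ₘ-commutativeRing : CommutativeRing 0ℓ 0ℓ
  +ₘ-*ₘ-commutativeRing = record
    { isCommutativeRing = record
      { isRing = record
        { +-isAbelianGroup = record
          { isGroup = record
            { isMonoid = record
              { isSemigroup = record
                { isMagma = record { isEquivalence = isEquivalence ; ∙-cong = cong₂ _+ₘ_ }
                ; assoc = +ₘ-assoc }
              ; identity = +ₘ-identityˡ , λ x → trans (+ₘ-comm x 0ₘ) (+ₘ-identityˡ x) }
            ; inverse = -ₘ-inverseˡ , λ x → trans (+ₘ-comm x (-ₘ x)) (-ₘ-inverseˡ x)
            ; ⁻¹-cong = cong -ₘ_ }
          ; comm = +ₘ-comm }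
        ; *-cong = cong₂ _*ₘ_
        ; *-assoc = *ₘ-assoc
        ; *-identity = *ₘ-identityˡ , λ x → trans (*ₘ-comm x 1ₘ) (*ₘ-identityˡ x)
        ; distrib = *ₘ-distribˡ-+ₘ , λ x y z → trans (*ₘ-comm (y +ₘ z) x)
            (trans (*ₘ-distribˡ-+ₘ x y z) (cong₂ _+ₘ_ (*ₘ-comm x y) (*ₘ-comm x z))) }
      ; *-comm = *ₘ-comm } }

  open CommutativeRing +ₘ-*ₘ-commutativeRing public using (distribʳ; zeroʳ; -‿inverseʳ)
  open import Algebra.Properties.CommutativeSemigroup (CommutativeRing.*-commutativeSemigroup +ₘ-*ₘ-commutativeRing) public
    using (x∙yz≈y∙xz)

p∤r⇒coprime : ∀ {p r} → Prime p → ¬ p ∣ r → Coprime r p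
p∤r⇒coprime p-prime p∤r (d∣r , d∣p) =
  [ (λ d≡1 → d≡1) , (λ d≡p → ⊥-elim (p∤r (subst (_∣ _) d≡p d∣r))) ]′ (prime⇒irreducible p-prime d∣p)

module PrimeField (p : ℕ) {{_ : NonZero p}} (p-prime : Prime p) where

  open Modular p

  p∣⇒≡0ₘ : ∀ {x : Fin p} → p ∣ toℕ x → x ≡ 0ₘ
  p∣⇒≡0ₘ {x} p∣x = toℕ-injective (trans (sym (m<n⇒m%n≡m (toℕ<n x))) (trans (n∣m⇒m%n≡0 _ p p∣x) (sym toℕ-0ₘ)))

  toℕ≡0⇒p∣ : ∀ m → toℕ (m mod p) ≡ 0 → p ∣ m
  toℕ≡0⇒p∣ m eq = m%n≡0⇒n∣m m p (trans (sym (toℕ-mod m)) eq)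

  x*y≡0⇒x≡0∨y≡0 : ∀ x y → x *ₘ y ≡ 0ₘ → x ≡ 0ₘ ⊎ y ≡ 0ₘ
  x*y≡0⇒x≡0∨y≡0 x y xy≡0 = Sum.map p∣⇒≡0ₘ p∣⇒≡0ₘ
    (euclidsLemma (toℕ x) (toℕ y) p-prime (toℕ≡0⇒p∣ _ (trans (cong toℕ xy≡0) toℕ-0ₘ)))

  x+x≡0⇒x≡0 : ¬ p ≡ 2 → ∀ x → x +ₘ x ≡ 0ₘ → x ≡ 0ₘ
  x+x≡0⇒x≡0 p≢2 x 2x≡0 with euclidsLemma 2 (toℕ x) p-prime p∣2x
    where
    p∣2x : p ∣ 2 ℕ.* toℕ x
    p∣2x = subst (p ∣_) (cong (toℕ x +_) (sym (ℕ.+-identityʳ (toℕ x))))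
             (toℕ≡0⇒p∣ _ (trans (cong toℕ 2x≡0) toℕ-0ₘ))
  ... | inj₁ p∣2 = ⊥-elim (p≢2 (ℕ.≤-antisym (∣⇒≤ p∣2) (nonTrivial⇒n>1 p {{prime⇒nonTrivial p-prime}})))
  ... | inj₂ p∣x = p∣⇒≡0ₘ p∣x

module _ {a₁ ℓ₁ a₂ ℓ₂} (A : Group a₁ ℓ₁) (B : Group a₂ ℓ₂) where

  private
    module A = Group A
    module B = Group B
    open import Algebra.Properties.Group B using (identityʳ-unique; inverseˡ-unique)

  module _ {f : A.Carrier → B.Carrier} (f-cong : ∀ {x y} → x A.≈ y → f x B.≈ f y)
           (∙-homo : ∀ x y → f (x A.∙ y) B.≈ f x B.∙ f y) where

    ∙-homo⇒ε-homo : f A.ε B.≈ B.ε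
    ∙-homo⇒ε-homo = identityʳ-unique (f A.ε) (f A.ε) (B.trans (B.sym (∙-homo A.ε A.ε)) (f-cong (A.identityˡ A.ε)))

    ∙-homo⇒⁻¹-homo : ∀ x → f (x A.⁻¹) B.≈ f x B.⁻¹
    ∙-homo⇒⁻¹-homo x = inverseˡ-unique (f (x A.⁻¹)) (f x)
      (B.trans (B.sym (∙-homo (x A.⁻¹) x)) (B.trans (f-cong (A.inverseˡ x)) ∙-homo⇒ε-homo))

module Vectors (p : ℕ) {{_ : NonZero p}} (d : ℕ) where

  open Modular p

  infixl 6 _+ᵥ_ _−ᵥ_
  infix 8 -ᵥ_
  infixr 7 _·_

  V : Set
  V = Vect p d

  _+ᵥ_ _−ᵥ_ : V → V → V
  _+ᵥ_ = vadd p
  u −ᵥ w = u +ᵥ vneg p w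

  -ᵥ_ : V → V
  -ᵥ_ = vneg p

  0ᵥ : V
  0ᵥ = vzero p

  _·_ : Fin p → V → V
  _·_ = vscale p

  ≡-by-lookup : ∀ {u w : V} → (∀ i → lookup u i ≡ lookup w i) → u ≡ w
  ≡-by-lookup {u} {w} eq = trans (sym (tabulate∘lookup u)) (trans (tabulate-cong eq) (tabulate∘lookup w))

  lookup-+ᵥ : ∀ u w i → lookup (u +ᵥ w) i ≡ lookup u i +ₘ lookup w i
  lookup-+ᵥ u w = lookup∘tabulate _

  lookup--ᵥ : ∀ u i → lookup (-ᵥ u) i ≡ -ₘ lookup u i
  lookup--ᵥ u = lookup∘tabulate _

  lookup-0ᵥ : ∀ i → lookup 0ᵥ i ≡ 0ₘ
  lookup-0ᵥ i = lookup-replicate i 0ₘ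

  lookup-· : ∀ x u i → lookup (x · u) i ≡ x *ₘ lookup u i
  lookup-· x u = lookup∘tabulate _

  +ᵥ-assoc : ∀ u w z → (u +ᵥ w) +ᵥ z ≡ u +ᵥ (w +ᵥ z)
  +ᵥ-assoc u w z = ≡-by-lookup λ i → begin
    lookup ((u +ᵥ w) +ᵥ z) i                    ≡⟨ trans (lookup-+ᵥ (u +ᵥ w) z i) (cong (_+ₘ lookup z i) (lookup-+ᵥ u w i)) ⟩
    (lookup u i +ₘ lookup w i) +ₘ lookup z i    ≡⟨ +ₘ-assoc (lookup u i) (lookup w i) (lookup z i) ⟩
    lookup u i +ₘ (lookup w i +ₘ lookup z i)    ≡⟨ trans (lookup-+ᵥ u (w +ᵥ z) i) (cong (lookup u i +ₘ_) (lookup-+ᵥ w z i)) ⟨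
    lookup (u +ᵥ (w +ᵥ z)) i                    ∎
    where open ≡-Reasoning

  +ᵥ-comm : ∀ u w → u +ᵥ w ≡ w +ᵥ u
  +ᵥ-comm u w = ≡-by-lookup λ i →
    trans (lookup-+ᵥ u w i) (trans (+ₘ-comm (lookup u i) (lookup w i)) (sym (lookup-+ᵥ w u i)))

  +ᵥ-identityˡ : ∀ u → 0ᵥ +ᵥ u ≡ u
  +ᵥ-identityˡ u = ≡-by-lookup λ i →
    trans (lookup-+ᵥ 0ᵥ u i) (trans (cong (_+ₘ lookup u i) (lookup-0ᵥ i)) (+ₘ-identityˡ (lookup u i)))

  -ᵥ-inverseˡ : ∀ u → -ᵥ u +ᵥ u ≡ 0ᵥ
  -ᵥ-inverseˡ u = ≡-by-lookup λ i → begin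
    lookup (-ᵥ u +ᵥ u) i               ≡⟨ trans (lookup-+ᵥ (-ᵥ u) u i) (cong (_+ₘ lookup u i) (lookup--ᵥ u i)) ⟩
    -ₘ lookup u i +ₘ lookup u i        ≡⟨ -ₘ-inverseˡ (lookup u i) ⟩
    0ₘ                                 ≡⟨ lookup-0ᵥ i ⟨
    lookup 0ᵥ i                        ∎
    where open ≡-Reasoning

  -ᵥ-inverseʳ : ∀ u → u +ᵥ -ᵥ u ≡ 0ᵥ
  -ᵥ-inverseʳ u = trans (+ᵥ-comm u (-ᵥ u)) (-ᵥ-inverseˡ u)

  ·-distribʳ : ∀ x y u → (x +ₘ y) · u ≡ x · u +ᵥ y · u
  ·-distribʳ x y u = ≡-by-lookup λ i → begin
    lookup ((x +ₘ y) · u) i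
      ≡⟨ lookup-· (x +ₘ y) u i ⟩
    (x +ₘ y) *ₘ lookup u i
      ≡⟨ distribʳ (lookup u i) x y ⟩
    x *ₘ lookup u i +ₘ y *ₘ lookup u i
      ≡⟨ trans (lookup-+ᵥ (x · u) (y · u) i) (cong₂ _+ₘ_ (lookup-· x u i) (lookup-· y u i)) ⟨
    lookup (x · u +ᵥ y · u) i
      ∎
    where open ≡-Reasoning

  ·-distribˡ : ∀ x u w → x · (u +ᵥ w) ≡ x · u +ᵥ x · w
  ·-distribˡ x u w = ≡-by-lookup λ i → begin
    lookup (x · (u +ᵥ w)) i
      ≡⟨ trans (lookup-· x (u +ᵥ w) i) (cong (x *ₘ_) (lookup-+ᵥ u w i)) ⟩
    x *ₘ (lookup u i +ₘ lookup w i)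
      ≡⟨ *ₘ-distribˡ-+ₘ x (lookup u i) (lookup w i) ⟩
    x *ₘ lookup u i +ₘ x *ₘ lookup w i
      ≡⟨ trans (lookup-+ᵥ (x · u) (x · w) i) (cong₂ _+ₘ_ (lookup-· x u i) (lookup-· x w i)) ⟨
    lookup (x · u +ᵥ x · w) i
      ∎
    where open ≡-Reasoning

  ·-identityˡ : ∀ u → 1ₘ · u ≡ u
  ·-identityˡ u = ≡-by-lookup λ i → trans (lookup-· 1ₘ u i) (*ₘ-identityˡ (lookup u i))

  +ᵥ-abelianGroup : AbelianGroup 0ℓ 0ℓ
  +ᵥ-abelianGroup = record
    { isAbelianGroup = record
      { isGroup = record
        { isMonoid = record
          { isSemigroup = record
            { isMagma = record { isEquivalence = isEquivalence ; ∙-cong = cong₂ _+ᵥ_ }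
            ; assoc = +ᵥ-assoc }
          ; identity = +ᵥ-identityˡ , λ u → trans (+ᵥ-comm u 0ᵥ) (+ᵥ-identityˡ u) }
        ; inverse = -ᵥ-inverseˡ , -ᵥ-inverseʳ
        ; ⁻¹-cong = cong -ᵥ_ }
      ; comm = +ᵥ-comm } }

  open AbelianGroupSolver +ᵥ-abelianGroup public using (solve; _⊜_; _⊕_; _⊖_; ⊝_; ∅)

  +ₘ-group : Group 0ℓ 0ℓ
  +ₘ-group = CommutativeRing.+-group +ₘ-*ₘ-commutativeRing

  +ᵥ-group : Group 0ℓ 0ℓ
  +ᵥ-group = AbelianGroup.group +ᵥ-abelianGroup

  ·-zeroˡ : ∀ u → 0ₘ · u ≡ 0ᵥ
  ·-zeroˡ u = ∙-homo⇒ε-homo +ₘ-group +ᵥ-group (cong (_· u)) (λ x y → ·-distribʳ x y u)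

  ·-zeroʳ : ∀ x → x · 0ᵥ ≡ 0ᵥ
  ·-zeroʳ x = ∙-homo⇒ε-homo +ᵥ-group +ᵥ-group (cong (x ·_)) (·-distribˡ x)

  -ₘ‿· : ∀ x u → (-ₘ x) · u ≡ -ᵥ (x · u)
  -ₘ‿· x u = ∙-homo⇒⁻¹-homo +ₘ-group +ᵥ-group (cong (_· u)) (λ x y → ·-distribʳ x y u) x

  ·‿-ᵥ : ∀ x u → x · (-ᵥ u) ≡ -ᵥ (x · u)
  ·‿-ᵥ x = ∙-homo⇒⁻¹-homo +ᵥ-group +ᵥ-group (cong (x ·_)) (·-distribˡ x)

  module _ (p-prime : Prime p) where

    open PrimeField p p-prime

    ·-cancelˡ : ∀ {x} u → ¬ x ≡ 0ₘ → x · u ≡ 0ᵥ → u ≡ 0ᵥ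
    ·-cancelˡ {x} u x≢0 xu≡0 = ≡-by-lookup λ i → trans (component i) (sym (lookup-0ᵥ i))
      where
      component : ∀ i → lookup u i ≡ 0ₘ
      component i with x*y≡0⇒x≡0∨y≡0 x (lookup u i)
                         (trans (sym (lookup-· x u i)) (trans (cong (λ z → lookup z i) xu≡0) (lookup-0ᵥ i)))
      ... | inj₁ x≡0  = ⊥-elim (x≢0 x≡0)
      ... | inj₂ uᵢ≡0 = uᵢ≡0

    u+u≡0⇒u≡0 : ¬ p ≡ 2 → ∀ u → u +ᵥ u ≡ 0ᵥ → u ≡ 0ᵥ
    u+u≡0⇒u≡0 p≢2 u 2u≡0 = ≡-by-lookup λ i → trans
      (x+x≡0⇒x≡0 p≢2 (lookup u i) (trans (sym (lookup-+ᵥ u u i)) (trans (cong (λ z → lookup z i) 2u≡0) (lookup-0ᵥ i))))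
      (sym (lookup-0ᵥ i))

    multiples-separate : ∀ {y z z′ x x′} → y ≡ x · z → 0ᵥ ≡ x · z′ → y ≡ x′ · z′ → y ≡ 0ᵥ
    multiples-separate {y} {z} {z′} {x} {x′} y≡xz 0≡xz′ y≡x′z′ with x Fin.≟ 0ₘ
    ... | yes x≡0 = trans y≡xz (trans (cong (_· z) x≡0) (·-zeroˡ z))
    ... | no  x≢0 = trans y≡x′z′ (trans (cong (x′ ·_) (·-cancelˡ z′ x≢0 (sym 0≡xz′))) (·-zeroʳ x′))

module LinearMaps (p : ℕ) {{_ : NonZero p}} where

  open Modular p
  open CommutativeRing +ₘ-*ₘ-commutativeRing using (+-commutativeSemigroup)
  open import Algebra.Properties.CommutativeSemigroup +-commutativeSemigroup using (interchange)

  record IsLinear {m n} (f : Vect p m → Vect p n) : Set where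
    private
      module Vm = Vectors p m
      module Vn = Vectors p n
    field
      +ᵥ-homo : ∀ u w → f (u Vm.+ᵥ w) ≡ f u Vn.+ᵥ f w
      ·-homo  : ∀ x u → f (x Vm.· u) ≡ x Vn.· f u

    0ᵥ-homo : f Vm.0ᵥ ≡ Vn.0ᵥ
    0ᵥ-homo = ∙-homo⇒ε-homo Vm.+ᵥ-group Vn.+ᵥ-group (cong f) +ᵥ-homo

    -ᵥ-homo : ∀ u → f (Vm.-ᵥ u) ≡ Vn.-ᵥ f u
    -ᵥ-homo = ∙-homo⇒⁻¹-homo Vm.+ᵥ-group Vn.+ᵥ-group (cong f) +ᵥ-homo

    −ᵥ-homo : ∀ u w → f (u Vm.−ᵥ w) ≡ f u Vn.−ᵥ f w
    −ᵥ-homo u w = trans (+ᵥ-homo u (Vm.-ᵥ w)) (cong (f u Vn.+ᵥ_) (-ᵥ-homo w))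

  open IsLinear public

  sumF-cong : ∀ {n} {f g : Fin n → Fin p} → (∀ j → f j ≡ g j) → sumF p f ≡ sumF p g
  sumF-cong {zero}  eq = refl
  sumF-cong {suc n} eq = cong₂ _+ₘ_ (eq zero) (sumF-cong (eq ∘ suc))

  sumF-+ₘ : ∀ {n} (f g : Fin n → Fin p) → sumF p (λ j → f j +ₘ g j) ≡ sumF p f +ₘ sumF p g
  sumF-+ₘ {zero}  f g = sym (+ₘ-identityˡ 0ₘ)
  sumF-+ₘ {suc n} f g = trans (cong (f zero +ₘ g zero +ₘ_) (sumF-+ₘ (f ∘ suc) (g ∘ suc)))
                              (interchange (f zero) (g zero) (sumF p (f ∘ suc)) (sumF p (g ∘ suc)))

  sumF-*ₘ : ∀ {n} x (f : Fin n → Fin p) → sumF p (λ j → x *ₘ f j) ≡ x *ₘ sumF p f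
  sumF-*ₘ {zero}  x f = sym (zeroʳ x)
  sumF-*ₘ {suc n} x f =
    trans (cong (x *ₘ f zero +ₘ_) (sumF-*ₘ x (f ∘ suc))) (sym (*ₘ-distribˡ-+ₘ x (f zero) (sumF p (f ∘ suc))))

  apply-isLinear : ∀ {m n} (M : Mat p m n) → IsLinear (apply p M)
  apply-isLinear {m} {n} M = record { +ᵥ-homo = +ᵥ-homo′ ; ·-homo = ·-homo′ }
    where
    module Vm = Vectors p m
    module Vn = Vectors p n

    lookup-apply : ∀ u i → lookup (apply p M u) i ≡ sumF p (λ j → M i j *ₘ lookup u j)
    lookup-apply u = lookup∘tabulate _

    +ᵥ-homo′ : ∀ u w → apply p M (u Vn.+ᵥ w) ≡ apply p M u Vm.+ᵥ apply p M w
    +ᵥ-homo′ u w = Vm.≡-by-lookup λ i → begin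
      lookup (apply p M (u Vn.+ᵥ w)) i
        ≡⟨ lookup-apply (u Vn.+ᵥ w) i ⟩
      sumF p (λ j → M i j *ₘ lookup (u Vn.+ᵥ w) j)
        ≡⟨ sumF-cong (λ j → trans (cong (M i j *ₘ_) (Vn.lookup-+ᵥ u w j)) (*ₘ-distribˡ-+ₘ (M i j) (lookup u j) (lookup w j))) ⟩
      sumF p (λ j → M i j *ₘ lookup u j +ₘ M i j *ₘ lookup w j)
        ≡⟨ sumF-+ₘ (λ j → M i j *ₘ lookup u j) (λ j → M i j *ₘ lookup w j) ⟩
      sumF p (λ j → M i j *ₘ lookup u j) +ₘ sumF p (λ j → M i j *ₘ lookup w j)
        ≡⟨ trans (Vm.lookup-+ᵥ (apply p M u) (apply p M w) i) (cong₂ _+ₘ_ (lookup-apply u i) (lookup-apply w i)) ⟨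
      lookup (apply p M u Vm.+ᵥ apply p M w) i
        ∎
      where open ≡-Reasoning

    ·-homo′ : ∀ x u → apply p M (x Vn.· u) ≡ x Vm.· apply p M u
    ·-homo′ x u = Vm.≡-by-lookup λ i → begin
      lookup (apply p M (x Vn.· u)) i
        ≡⟨ lookup-apply (x Vn.· u) i ⟩
      sumF p (λ j → M i j *ₘ lookup (x Vn.· u) j)
        ≡⟨ sumF-cong (λ j → trans (cong (M i j *ₘ_) (Vn.lookup-· x u j)) (x∙yz≈y∙xz (M i j) x (lookup u j))) ⟩
      sumF p (λ j → x *ₘ (M i j *ₘ lookup u j))
        ≡⟨ sumF-*ₘ x (λ j → M i j *ₘ lookup u j) ⟩
      x *ₘ sumF p (λ j → M i j *ₘ lookup u j)
        ≡⟨ trans (Vm.lookup-· x (apply p M u) i) (cong (x *ₘ_) (lookup-apply u i)) ⟨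
      lookup (x Vm.· apply p M u) i
        ∎
      where open ≡-Reasoning

  module _ {d : ℕ} where

    open Vectors p d

    id-isLinear : IsLinear {d} id
    id-isLinear = record { +ᵥ-homo = λ _ _ → refl ; ·-homo = λ _ _ → refl }

    ∘-isLinear : ∀ {f g : V → V} → IsLinear f → IsLinear g → IsLinear (f ∘ g)
    ∘-isLinear {f} {g} f-lin g-lin = record
      { +ᵥ-homo = λ u w → trans (cong f (+ᵥ-homo g-lin u w)) (+ᵥ-homo f-lin (g u) (g w))
      ; ·-homo  = λ x u → trans (cong f (·-homo g-lin x u)) (·-homo f-lin x (g u)) }

    +-isLinear : ∀ {f g : V → V} → IsLinear f → IsLinear g → IsLinear (λ u → f u +ᵥ g u)
    +-isLinear {f} {g} f-lin g-lin = record
      { +ᵥ-homo = λ u w → trans (cong₂ _+ᵥ_ (+ᵥ-homo f-lin u w) (+ᵥ-homo g-lin u w))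
                                (solve 4 (λ a b c e → (a ⊕ b) ⊕ (c ⊕ e) ⊜ (a ⊕ c) ⊕ (b ⊕ e)) refl (f u) (f w) (g u) (g w))
      ; ·-homo  = λ x u → trans (cong₂ _+ᵥ_ (·-homo f-lin x u) (·-homo g-lin x u)) (sym (·-distribˡ x (f u) (g u))) }

    -ᵥ-isLinear : IsLinear -ᵥ_
    -ᵥ-isLinear = record
      { +ᵥ-homo = λ u w → solve 2 (λ a b → ⊝ (a ⊕ b) ⊜ ⊝ a ⊕ ⊝ b) refl u w
      ; ·-homo  = λ x u → sym (·‿-ᵥ x u) }

module Dihedral (r : ℕ) {{_ : NonZero r}} where

  open Modular r
  open AbelianGroupSolver (CommutativeRing.+-abelianGroup +ₘ-*ₘ-commutativeRing) using (solve; _⊜_; _⊕_; ⊝_; ∅)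

  reflection-∙ : ∀ a b t → dmul r (a , true) (b , t) ≡ (a +ₘ -ₘ b , not t)
  reflection-∙ a b t = cong (_, not t) (mod-cong (sym (mod-absorbʳ-+ (toℕ a) (r ∸ toℕ b))))

  reflection-involutive : ∀ c → dmul r (c , true) (c , true) ≡ de r
  reflection-involutive c = trans (reflection-∙ c c true) (cong (_, false) (-‿inverseʳ c))

  -- {x^z | 2z = 0} ∪ {x^z y | 2z = 2c}: the subgroup generated by x^c y and the rotations of order at most 2
  HalfTurnSubgroup : Fin r → Dih r → Set
  HalfTurnSubgroup c (z , false) = z +ₘ z ≡ 0ₘ
  HalfTurnSubgroup c (z , true)  = z +ₘ z ≡ c +ₘ c

  HalfTurnSubgroup-e : ∀ c → HalfTurnSubgroup c (de r)
  HalfTurnSubgroup-e c = +ₘ-identityˡ 0ₘ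

  private
    double-+ : ∀ x y → (x +ₘ y) +ₘ (x +ₘ y) ≡ (x +ₘ x) +ₘ (y +ₘ y)
    double-+ = solve 2 (λ x y → (x ⊕ y) ⊕ (x ⊕ y) ⊜ (x ⊕ x) ⊕ (y ⊕ y)) refl

    double-− : ∀ x y → (x +ₘ -ₘ y) +ₘ (x +ₘ -ₘ y) ≡ (x +ₘ x) +ₘ -ₘ (y +ₘ y)
    double-− = solve 2 (λ x y → (x ⊕ ⊝ y) ⊕ (x ⊕ ⊝ y) ⊜ (x ⊕ x) ⊕ ⊝ (y ⊕ y)) refl

    x-0≡x : ∀ x → x +ₘ -ₘ 0ₘ ≡ x
    x-0≡x = solve 1 (λ x → x ⊕ ⊝ ∅ ⊜ x) refl

  HalfTurnSubgroup-rotation : ∀ c u → u +ₘ u ≡ 0ₘ → ∀ k → HalfTurnSubgroup c k → HalfTurnSubgroup c (dmul r (u , false) k)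
  HalfTurnSubgroup-rotation c u 2u≡0 (z , false) 2z≡0 =
    trans (double-+ u z) (trans (cong₂ _+ₘ_ 2u≡0 2z≡0) (+ₘ-identityˡ 0ₘ))
  HalfTurnSubgroup-rotation c u 2u≡0 (z , true) 2z≡2c =
    trans (double-+ u z) (trans (cong₂ _+ₘ_ 2u≡0 2z≡2c) (+ₘ-identityˡ (c +ₘ c)))

  HalfTurnSubgroup-reflection : ∀ c k → HalfTurnSubgroup c k → HalfTurnSubgroup c (dmul r (c , true) k)
  HalfTurnSubgroup-reflection c (z , false) 2z≡0 = subst (HalfTurnSubgroup c) (sym (reflection-∙ c z false))
    (trans (double-− c z) (trans (cong (λ s → c +ₘ c +ₘ -ₘ s) 2z≡0) (x-0≡x (c +ₘ c))))
  HalfTurnSubgroup-reflection c (z , true) 2z≡2c = subst (HalfTurnSubgroup c) (sym (reflection-∙ c z true))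
    (trans (double-− c z) (trans (cong (λ s → c +ₘ c +ₘ -ₘ s) 2z≡2c) (-‿inverseʳ (c +ₘ c))))

  -ₘ-double : ∀ u → u +ₘ u ≡ 0ₘ → -ₘ u +ₘ -ₘ u ≡ 0ₘ
  -ₘ-double u 2u≡0 =
    trans (solve 1 (λ u → ⊝ u ⊕ ⊝ u ⊜ ⊝ (u ⊕ u)) refl u) (trans (cong -ₘ_ 2u≡0) (solve 0 (⊝ ∅ ⊜ ∅) refl))

  1ₘ∉HalfTurnSubgroup : 3 ≤ r → ∀ c → ¬ HalfTurnSubgroup c (1ₘ , false)
  1ₘ∉HalfTurnSubgroup 3≤r c 1+1≡0 = ℕ.1+n≢0 (begin
    2
      ≡⟨ m<n⇒m%n≡m 3≤r ⟨
    2 % r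
      ≡⟨ cong (λ k → (k + k) % r) (trans (toℕ-mod 1) (m<n⇒m%n≡m (ℕ.≤-trans (ℕ.n≤1+n 2) 3≤r))) ⟨
    (toℕ 1ₘ + toℕ 1ₘ) % r
      ≡⟨ toℕ-mod _ ⟨
    toℕ (1ₘ +ₘ 1ₘ)
      ≡⟨ cong toℕ 1+1≡0 ⟩
    toℕ 0ₘ
      ≡⟨ toℕ-0ₘ ⟩
    0
      ∎)
    where open ≡-Reasoning

  r∣2u⇒u+u≡0 : ∀ u → r ∣ 2 ℕ.* toℕ u → u +ₘ u ≡ 0ₘ
  r∣2u⇒u+u≡0 u r∣2u = mod-cong (begin
    (toℕ u + toℕ u) % r          ≡⟨ cong (λ k → (toℕ u + k) % r) (ℕ.+-identityʳ (toℕ u)) ⟨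
    (2 ℕ.* toℕ u) % r            ≡⟨ n∣m⇒m%n≡0 _ r r∣2u ⟩
    0                            ≡⟨ m*n%n≡0 0 r ⟨
    0 % r                        ∎)
    where open ≡-Reasoning

  coprime∧r∣2pu⇒u+u≡0 : ∀ {p} u → Coprime r p → r ∣ 2 ℕ.* p ℕ.* toℕ u → u +ₘ u ≡ 0ₘ
  coprime∧r∣2pu⇒u+u≡0 {p} u coprime r∣2pu = r∣2u⇒u+u≡0 u (coprime-divisor coprime (subst (r ∣_) 2p·u≡p·2u r∣2pu))
    where
    2p·u≡p·2u : 2 ℕ.* p ℕ.* toℕ u ≡ p ℕ.* (2 ℕ.* toℕ u)
    2p·u≡p·2u = trans (cong (ℕ._* toℕ u) (ℕ.*-comm 2 p)) (ℕ.*-assoc p 2 (toℕ u))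

module SemidirectProduct (p : ℕ) {{_ : NonZero p}} (r : ℕ) {{_ : NonZero r}}
  (n : ℕ) (d : Fin n → ℕ) (ψs : (i : Fin n) → Rep p r (d i)) where

  open Modular r using (_+ₘ_; -ₘ_; 0ₘ; 1ₘ; toℕ-mod; toℕ-0ₘ; mod-cong; mod-absorbʳ-+)

  𝔾 : Set
  𝔾 = SD p r n d ψs

  infixr 7 _∙_

  _∙_ : 𝔾 → 𝔾 → 𝔾
  _∙_ = smul p r n d ψs

  _⁻¹ : 𝔾 → 𝔾
  _⁻¹ = sinv p r n d ψs

  generated-induction : ∀ {ρ τ} → Generates p r n d ψs ρ τ → (P : 𝔾 → Set) →
    (∀ {x y} → _≈ˢ_ p r n d ψs x y → P x → P y) → P (se p r n d ψs) →
    (∀ x → P x → P (ρ ∙ x)) → (∀ x → P x → P (ρ ⁻¹ ∙ x)) →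
    (∀ x → P x → P (τ ∙ x)) → (∀ x → P x → P (τ ⁻¹ ∙ x)) →
    ∀ x → P x
  generated-induction {ρ} {τ} generates P P-resp P-e P-ρ P-ρ⁻¹ P-τ P-τ⁻¹ x =
    P-resp (proj₂ (generates x)) (P-word (proj₁ (generates x)))
    where
    P-word : ∀ ws → P (evalWord p r n d ψs ρ τ ws)
    P-word []        = P-e
    P-word (ρ⁺ ∷ ws) = P-ρ _ (P-word ws)
    P-word (ρ⁻ ∷ ws) = P-ρ⁻¹ _ (P-word ws)
    P-word (τ⁺ ∷ ws) = P-τ _ (P-word ws)
    P-word (τ⁻ ∷ ws) = P-τ⁻¹ _ (P-word ws)

  rotation-power : ∀ vs u m → proj₂ (spow p r n d ψs (vs , (u , false)) m) ≡ ((m ℕ.* toℕ u) mod r , false)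
  rotation-power vs u zero    = refl
  rotation-power vs u (suc m) = trans (cong (λ k → (toℕ u + toℕ (proj₁ k)) mod r , proj₂ k) (rotation-power vs u m))
    (cong (_, false) (mod-cong (mod-absorbʳ-+ (toℕ u) (m ℕ.* toℕ u))))

  open Dihedral r

  dihedral-induction : ∀ {ρ τ} → Generates p r n d ψs ρ τ → (P : Dih r → Set) → P (de r) →
    (∀ k → P k → P (dmul r (proj₂ ρ) k)) → (∀ k → P k → P (dmul r (dinv r (proj₂ ρ)) k)) →
    (∀ k → P k → P (dmul r (proj₂ τ) k)) → (∀ k → P k → P (dmul r (dinv r (proj₂ τ)) k)) →
    ∀ k → P k
  dihedral-induction generates P P-e P-ρ P-ρ⁻¹ P-τ P-τ⁻¹ k =
    generated-induction generates (P ∘ proj₂) (λ x≈y → subst P (proj₂ x≈y)) P-e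
      (λ x → P-ρ (proj₂ x)) (λ x → P-ρ⁻¹ (proj₂ x)) (λ x → P-τ (proj₂ x)) (λ x → P-τ⁻¹ (proj₂ x))
      ((λ _ → vzero p) , k)

  rotations-do-not-generate : ∀ vs ws u u′ → ¬ Generates p r n d ψs (vs , (u , false)) (ws , (u′ , false))
  rotations-do-not-generate vs ws u u′ generates =
    false≢true (dihedral-induction generates (λ k → proj₂ k ≡ false) refl
                  (λ _ → id) (λ _ → id) (λ _ → id) (λ _ → id) (u , true))
    where
    false≢true : ¬ true ≡ false
    false≢true ()

  half-turn-and-reflection-do-not-generate : 3 ≤ r → ∀ vs ws u c → u +ₘ u ≡ 0ₘ →
    ¬ Generates p r n d ψs (vs , (u , false)) (ws , (c , true))
  half-turn-and-reflection-do-not-generate 3≤r vs ws u c 2u≡0 generates =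
    1ₘ∉HalfTurnSubgroup 3≤r c (dihedral-induction generates (HalfTurnSubgroup c) (HalfTurnSubgroup-e c)
      (HalfTurnSubgroup-rotation c u 2u≡0) (HalfTurnSubgroup-rotation c (-ₘ u) (-ₘ-double u 2u≡0))
      (HalfTurnSubgroup-reflection c) (HalfTurnSubgroup-reflection c) (1ₘ , false))

  reflection-and-half-turn-do-not-generate : 3 ≤ r → ∀ vs ws c u → u +ₘ u ≡ 0ₘ →
    ¬ Generates p r n d ψs (vs , (c , true)) (ws , (u , false))
  reflection-and-half-turn-do-not-generate 3≤r vs ws c u 2u≡0 generates =
    1ₘ∉HalfTurnSubgroup 3≤r c (dihedral-induction generates (HalfTurnSubgroup c) (HalfTurnSubgroup-e c)
      (HalfTurnSubgroup-reflection c) (HalfTurnSubgroup-reflection c)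
      (HalfTurnSubgroup-rotation c u 2u≡0) (HalfTurnSubgroup-rotation c (-ₘ u) (-ₘ-double u 2u≡0)) (1ₘ , false))

  rotation-order : ∀ {vs u m} → HasOrder p r n d ψs (vs , (u , false)) m → r ∣ m ℕ.* toℕ u
  rotation-order {vs} {u} {m} order = m%n≡0⇒n∣m _ r (begin
    (m ℕ.* toℕ u) % r
      ≡⟨ toℕ-mod _ ⟨
    toℕ ((m ℕ.* toℕ u) mod r)
      ≡⟨ cong (toℕ ∘ proj₁) (trans (sym (rotation-power vs u m)) (proj₂ (proj₁ order))) ⟩
    toℕ (0 mod r)
      ≡⟨ toℕ-0ₘ ⟩
    0
      ∎)
    where open ≡-Reasoning

module Representation {p : ℕ} {{_ : NonZero p}} {r : ℕ} {{_ : NonZero r}} {d : ℕ} (R : Rep p r d) where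

  open Vectors p d
  open LinearMaps p

  act : Dih r → V → V
  act k = apply p (ψ R k)

  act-isLinear : ∀ k → IsLinear (act k)
  act-isLinear k = apply-isLinear (ψ R k)

  act-e : ∀ u → act (de r) u ≡ u
  act-e = ψ-e R

  act-∙ : ∀ k l u → act (dmul r k l) u ≡ act k (act l u)
  act-∙ = ψ-mul R

  act-reflection-involutive : ∀ c u → act (c , true) (act (c , true) u) ≡ u
  act-reflection-involutive c u =
    trans (sym (act-∙ _ _ u)) (trans (cong (λ k → act k u) (Dihedral.reflection-involutive r c)) (act-e u))

module ReflectionPair {p : ℕ} {{_ : NonZero p}} {r : ℕ} {{_ : NonZero r}} {d : ℕ} (R : Rep p r d) (a b : Fin r) where

  open Modular p using (_+ₘ_; -ₘ_; 0ₘ; 1ₘ)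
  open Vectors p d
  open LinearMaps p
  open Representation R

  g h : Dih r
  g = a , true
  h = b , true

  G H X X⁻¹ : V → V
  G = act g
  H = act h
  X u = G (H u)
  X⁻¹ u = H (G u)

  G-involutive : ∀ u → G (G u) ≡ u
  G-involutive = act-reflection-involutive a

  H-involutive : ∀ u → H (H u) ≡ u
  H-involutive = act-reflection-involutive b

  X-X⁻¹ : ∀ u → X (X⁻¹ u) ≡ u
  X-X⁻¹ u = trans (cong G (H-involutive (G u))) (G-involutive u)

  X⁻¹-X : ∀ u → X⁻¹ (X u) ≡ u
  X⁻¹-X u = trans (cong H (G-involutive (H u))) (H-involutive u)

  G-isLinear : IsLinear G
  G-isLinear = act-isLinear g

  H-isLinear : IsLinear H
  H-isLinear = act-isLinear h

  X-isLinear : IsLinear X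
  X-isLinear = ∘-isLinear G-isLinear H-isLinear

  X⁻¹-isLinear : IsLinear X⁻¹
  X⁻¹-isLinear = ∘-isLinear H-isLinear G-isLinear

  CommutesWithX : (V → V) → Set
  CommutesWithX φ = ∀ u → φ (X u) ≡ X (φ u)

  commutesWithX⇒X⁻¹ : ∀ {φ} → CommutesWithX φ → ∀ u → φ (X⁻¹ u) ≡ X⁻¹ (φ u)
  commutesWithX⇒X⁻¹ {φ} φX≡Xφ u = begin
    φ (X⁻¹ u)             ≡⟨ X⁻¹-X (φ (X⁻¹ u)) ⟨
    X⁻¹ (X (φ (X⁻¹ u)))   ≡⟨ cong X⁻¹ (φX≡Xφ (X⁻¹ u)) ⟨
    X⁻¹ (φ (X (X⁻¹ u)))   ≡⟨ cong (X⁻¹ ∘ φ) (X-X⁻¹ u) ⟩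
    X⁻¹ (φ u)             ∎
    where open ≡-Reasoning

  -- The ⟨X⟩-submodule of V × V generated by (z , z′).
  XSpan : V → V → V → V → Set
  XSpan z z′ y y′ = Σ (V → V) λ φ → IsLinear φ × CommutesWithX φ × y ≡ φ z × y′ ≡ φ z′

  module _ {z z′ : V} where

    XSpan-generator : XSpan z z′ z z′
    XSpan-generator = id , id-isLinear , (λ _ → refl) , refl , refl

    XSpan-+ᵥ : ∀ {y y′ x x′} → XSpan z z′ y y′ → XSpan z z′ x x′ → XSpan z z′ (y +ᵥ x) (y′ +ᵥ x′)
    XSpan-+ᵥ (φ , φ-lin , φX , y≡ , y′≡) (χ , χ-lin , χX , x≡ , x′≡) =
      (λ u → φ u +ᵥ χ u) , +-isLinear φ-lin χ-lin ,
      (λ u → trans (cong₂ _+ᵥ_ (φX u) (χX u)) (sym (+ᵥ-homo X-isLinear (φ u) (χ u)))) ,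
      cong₂ _+ᵥ_ y≡ x≡ , cong₂ _+ᵥ_ y′≡ x′≡

    XSpan-∘ : ∀ {f} → IsLinear f → CommutesWithX f → ∀ {y y′} → XSpan z z′ y y′ → XSpan z z′ (f y) (f y′)
    XSpan-∘ {f} f-lin fX (φ , φ-lin , φX , y≡ , y′≡) =
      f ∘ φ , ∘-isLinear f-lin φ-lin , (λ u → trans (cong f (φX u)) (fX (φ u))) , cong f y≡ , cong f y′≡

    XSpan-X : ∀ {y y′} → XSpan z z′ y y′ → XSpan z z′ (X y) (X y′)
    XSpan-X = XSpan-∘ X-isLinear (λ _ → refl)

    XSpan-X⁻¹ : ∀ {y y′} → XSpan z z′ y y′ → XSpan z z′ (X⁻¹ y) (X⁻¹ y′)
    XSpan-X⁻¹ = XSpan-∘ X⁻¹-isLinear (λ u → trans (X⁻¹-X u) (sym (X-X⁻¹ u)))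

    XSpan--ᵥ : ∀ {y y′} → XSpan z z′ y y′ → XSpan z z′ (-ᵥ y) (-ᵥ y′)
    XSpan--ᵥ = XSpan-∘ -ᵥ-isLinear (λ u → sym (-ᵥ-homo X-isLinear u))

    XSpan-−ᵥ : ∀ {y y′ x x′} → XSpan z z′ y y′ → XSpan z z′ x x′ → XSpan z z′ (y −ᵥ x) (y′ −ᵥ x′)
    XSpan-−ᵥ y∈ x∈ = XSpan-+ᵥ y∈ (XSpan--ᵥ x∈)

    XSpan-1-X : XSpan z z′ (z −ᵥ X z) (z′ −ᵥ X z′)
    XSpan-1-X = XSpan-−ᵥ XSpan-generator (XSpan-X XSpan-generator)

  module Irreducibility (irreducible : Irreducible p r R)
    (g-h-generate : ∀ (P : Dih r → Set) → P (de r) →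
                    (∀ k → P k → P (dmul r g k)) → (∀ k → P k → P (dmul r h k)) → ∀ k → P k)
    where

    IsSubspace : (V → Set) → Set
    IsSubspace W = W 0ᵥ × (∀ u w → W u → W w → W (u +ᵥ w)) × (∀ x u → W u → W (x · u))

    subspace-dichotomy : ∀ W → IsSubspace W → (∀ u → W u → W (G u)) → (∀ u → W u → W (H u)) →
                         (∀ u → W u → u ≡ 0ᵥ) ⊎ (∀ u → W u)
    subspace-dichotomy W (W-0 , W-+ , W-·) W-G W-H = proj₂ irreducible W (W-0 , W-+ , W-· , W-act)
      where
      W-act : ∀ k u → W u → W (act k u)
      W-act = g-h-generate (λ k → ∀ u → W u → W (act k u))
        (λ u Wu → subst W (sym (act-e u)) Wu)
        (λ k W-k u Wu → subst W (sym (act-∙ g k u)) (W-G _ (W-k u Wu)))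
        (λ k W-k u Wu → subst W (sym (act-∙ h k u)) (W-H _ (W-k u Wu)))

    nonzero-vector : ∃ λ u → ¬ u ≡ 0ᵥ
    nonzero-vector = proj₁ irreducible

    X-fixed-dichotomy : (∀ u → X u ≡ u → u ≡ 0ᵥ) ⊎ (∀ u → X u ≡ u)
    X-fixed-dichotomy = subspace-dichotomy (λ u → X u ≡ u)
      ( 0ᵥ-homo X-isLinear
      , (λ u w Xu≡u Xw≡w → trans (+ᵥ-homo X-isLinear u w) (cong₂ _+ᵥ_ Xu≡u Xw≡w))
      , (λ x u Xu≡u → trans (·-homo X-isLinear x u) (cong (x ·_) Xu≡u)) )
      (λ u Xu≡u → cong G (trans (cong X⁻¹ (sym Xu≡u)) (X⁻¹-X u)))
      (λ u Xu≡u → trans (cong G (H-involutive u)) (trans (cong G (sym Xu≡u)) (G-involutive (H u))))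

    -- {u | φ u = φ (G u) = 0} is a subrepresentation because φ commutes with X and X⁻¹.
    annihilator-dichotomy : ∀ {φ z} → IsLinear φ → CommutesWithX φ → G z ≡ z → φ z ≡ 0ᵥ →
                            z ≡ 0ᵥ ⊎ (∀ u → φ u ≡ 0ᵥ)
    annihilator-dichotomy {φ} {z} φ-lin φX Gz≡z φz≡0 =
      Sum.map (λ W⊆0 → W⊆0 z (φz≡0 , trans (cong φ Gz≡z) φz≡0)) (λ W≡V u → proj₁ (W≡V u))
        (subspace-dichotomy W W-subspace W-G W-H)
      where
      W : V → Set
      W u = φ u ≡ 0ᵥ × φ (G u) ≡ 0ᵥ

      W-subspace : IsSubspace W
      W-subspace =
        ( (0ᵥ-homo φ-lin , trans (cong φ (0ᵥ-homo G-isLinear)) (0ᵥ-homo φ-lin))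
        , (λ u w (φu , φGu) (φw , φGw) →
            ( trans (+ᵥ-homo φ-lin u w) (trans (cong₂ _+ᵥ_ φu φw) (+ᵥ-identityˡ 0ᵥ))
            , trans (cong φ (+ᵥ-homo G-isLinear u w)) (trans (+ᵥ-homo φ-lin (G u) (G w))
                (trans (cong₂ _+ᵥ_ φGu φGw) (+ᵥ-identityˡ 0ᵥ)))))
        , (λ x u (φu , φGu) →
            ( trans (·-homo φ-lin x u) (trans (cong (x ·_) φu) (·-zeroʳ x))
            , trans (cong φ (·-homo G-isLinear x u)) (trans (·-homo φ-lin x (G u)) (trans (cong (x ·_) φGu) (·-zeroʳ x))))) )

      W-G : ∀ u → W u → W (G u)
      W-G u (φu , φGu) = φGu , trans (cong φ (G-involutive u)) φu

      W-H : ∀ u → W u → W (H u)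
      W-H u (φu , φGu) =
        ( trans (cong φ (sym (cong H (G-involutive u))))
            (trans (commutesWithX⇒X⁻¹ {φ} φX (G u)) (trans (cong X⁻¹ φGu) (0ᵥ-homo X⁻¹-isLinear)))
        , trans (φX u) (trans (cong X φu) (0ᵥ-homo X-isLinear)) )

    XSpan-separates : ∀ {z z′ y} → G z′ ≡ z′ → XSpan z z′ y 0ᵥ → XSpan z z′ 0ᵥ y → y ≡ 0ᵥ
    XSpan-separates {z} Gz′≡z′ (φ , φ-lin , φX , y≡φz , 0≡φz′) (χ , χ-lin , _ , _ , y≡χz′) =
      [ (λ z′≡0 → trans y≡χz′ (trans (cong χ z′≡0) (0ᵥ-homo χ-lin)))
      , (λ φ≡0 → trans y≡φz (φ≡0 z)) ]′ (annihilator-dichotomy φ-lin φX Gz′≡z′ (sym 0≡φz′))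

  τ²≡e⇒H-w : ∀ w → w +ᵥ H (w +ᵥ H 0ᵥ) ≡ 0ᵥ → H w ≡ -ᵥ w
  τ²≡e⇒H-w w τ²≡e = inverseʳ-unique w (H w) (trans (cong (λ x → w +ᵥ H x) (sym w+H0≡w)) τ²≡e)
    where
    open import Algebra.Properties.AbelianGroup +ᵥ-abelianGroup using (inverseʳ-unique)
    w+H0≡w : w +ᵥ H 0ᵥ ≡ w
    w+H0≡w = trans (cong (w +ᵥ_) (0ᵥ-homo H-isLinear)) (solve 1 (λ w → w ⊕ ∅ ⊜ w) refl w)

  -- ρ = (v , g) and τ = (w , h) acting on the left of V ⋊ D_{2r}; τ² = 1 amounts to H w = -w.
  module Translation (v w : V) (H-w : H w ≡ -ᵥ w) where

    -- ρ² = (u₂ , 1) and ρτ = (t , gh)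
    u₂ t : V
    u₂ = v +ᵥ G v
    t  = v +ᵥ G w

    G-u₂ : G u₂ ≡ u₂
    G-u₂ = trans (+ᵥ-homo G-isLinear v (G v)) (trans (cong (G v +ᵥ_) (G-involutive v)) (+ᵥ-comm (G v) v))

    G[-Gv] : G (-ᵥ G v) ≡ -ᵥ v
    G[-Gv] = trans (-ᵥ-homo G-isLinear (G v)) (cong -ᵥ_ (G-involutive v))

    G-act-g : ∀ k → G (act (dmul r g k) t) ≡ act k t
    G-act-g k = trans (cong G (act-∙ g k t)) (G-involutive (act k t))

    gap : V → V → V
    gap c s = (c −ᵥ X c) −ᵥ (t −ᵥ s)

    -- defect c k = (1 − X) c − (1 − k) t on rotations k, and the defect of ρ (c , k) on reflections.
    -- Left multiplication by ρ, ρ⁻¹ or τ changes it by 0 or ±(1 − X) u₂, or applies X or X⁻¹ to it.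
    defect : V → Dih r → V
    defect c (z , false) = gap c (act (z , false) t)
    defect c (z , true)  = gap (v +ᵥ G c) (G (act (z , true) t))

    gap-shift : ∀ m c s → gap (m +ᵥ c) s ≡ gap c s +ᵥ (m −ᵥ X m)
    gap-shift m c s = trans (cong (λ x → ((m +ᵥ c) −ᵥ x) −ᵥ (t −ᵥ s)) (+ᵥ-homo X-isLinear m c))
      (solve 6 (λ m c Xm Xc t s → ((m ⊕ c) ⊖ (Xm ⊕ Xc)) ⊖ (t ⊖ s) ⊜ ((c ⊖ Xc) ⊖ (t ⊖ s)) ⊕ (m ⊖ Xm))
        refl m c (X m) (X c) t s)

    defect-e : ∀ c → defect c (de r) ≡ c −ᵥ X c
    defect-e c = trans (cong (gap c) (act-e t)) (solve 3 (λ c Xc t → (c ⊖ Xc) ⊖ (t ⊖ t) ⊜ c ⊖ Xc) refl c (X c) t)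

    defect-ρ-rotation : ∀ c z → defect (v +ᵥ G c) (dmul r g (z , false)) ≡ defect c (z , false) +ᵥ (u₂ −ᵥ X u₂)
    defect-ρ-rotation c z = trans (cong₂ gap v+G[v+Gc] (G-act-g (z , false))) (gap-shift u₂ c (act (z , false) t))
      where
      v+G[v+Gc] : v +ᵥ G (v +ᵥ G c) ≡ u₂ +ᵥ c
      v+G[v+Gc] = trans (cong (v +ᵥ_) (trans (+ᵥ-homo G-isLinear v (G c)) (cong (G v +ᵥ_) (G-involutive c))))
        (solve 3 (λ v Gv c → v ⊕ (Gv ⊕ c) ⊜ (v ⊕ Gv) ⊕ c) refl v (G v) c)

    defect-ρ-reflection : ∀ c z → defect (v +ᵥ G c) (dmul r g (z , true)) ≡ defect c (z , true)
    defect-ρ-reflection c z = cong (gap (v +ᵥ G c)) (act-∙ g (z , true) t)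

    defect-ρ⁻¹-rotation : ∀ c z → defect (-ᵥ G v +ᵥ G c) (dmul r g (z , false)) ≡ defect c (z , false)
    defect-ρ⁻¹-rotation c z = cong₂ gap v+G[-Gv+Gc] (G-act-g (z , false))
      where
      v+G[-Gv+Gc] : v +ᵥ G (-ᵥ G v +ᵥ G c) ≡ c
      v+G[-Gv+Gc] = begin
        v +ᵥ G (-ᵥ G v +ᵥ G c)          ≡⟨ cong (v +ᵥ_) (+ᵥ-homo G-isLinear (-ᵥ G v) (G c)) ⟩
        v +ᵥ (G (-ᵥ G v) +ᵥ G (G c))    ≡⟨ cong (λ x → v +ᵥ (x +ᵥ G (G c))) (-ᵥ-homo G-isLinear (G v)) ⟩
        v +ᵥ (-ᵥ G (G v) +ᵥ G (G c))    ≡⟨ cong₂ (λ x y → v +ᵥ (-ᵥ x +ᵥ y)) (G-involutive v) (G-involutive c) ⟩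
        v +ᵥ (-ᵥ v +ᵥ c)                ≡⟨ solve 2 (λ v c → v ⊕ (⊝ v ⊕ c) ⊜ c) refl v c ⟩
        c                               ∎
        where open ≡-Reasoning

    defect-ρ⁻¹-reflection : ∀ c z → defect (-ᵥ G v +ᵥ G c) (dmul r g (z , true)) ≡ defect c (z , true) −ᵥ (u₂ −ᵥ X u₂)
    defect-ρ⁻¹-reflection c z = begin
      gap (-ᵥ G v +ᵥ G c) (act (dmul r g (z , true)) t)
        ≡⟨ cong₂ gap -Gv+Gc (act-∙ g (z , true) t) ⟩
      gap (-ᵥ u₂ +ᵥ (v +ᵥ G c)) s
        ≡⟨ gap-shift (-ᵥ u₂) (v +ᵥ G c) s ⟩
      defect c (z , true) +ᵥ (-ᵥ u₂ −ᵥ X (-ᵥ u₂))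
        ≡⟨ cong (λ x → defect c (z , true) +ᵥ (-ᵥ u₂ −ᵥ x)) (-ᵥ-homo X-isLinear u₂) ⟩
      defect c (z , true) +ᵥ (-ᵥ u₂ −ᵥ -ᵥ X u₂)
        ≡⟨ solve 3 (λ δ u Xu → δ ⊕ (⊝ u ⊖ ⊝ Xu) ⊜ δ ⊖ (u ⊖ Xu)) refl (defect c (z , true)) u₂ (X u₂) ⟩
      defect c (z , true) −ᵥ (u₂ −ᵥ X u₂)
        ∎
      where
      open ≡-Reasoning
      s = G (act (z , true) t)
      -Gv+Gc : -ᵥ G v +ᵥ G c ≡ -ᵥ u₂ +ᵥ (v +ᵥ G c)
      -Gv+Gc = solve 3 (λ v Gv Gc → ⊝ Gv ⊕ Gc ⊜ ⊝ (v ⊕ Gv) ⊕ (v ⊕ Gc)) refl v (G v) (G c)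

    defect-τ-rotation : ∀ c z → defect (w +ᵥ H c) (dmul r h (z , false)) ≡ X (defect c (z , false))
    defect-τ-rotation c z = begin
      gap (v +ᵥ G (w +ᵥ H c)) (G (act (dmul r h (z , false)) t))
        ≡⟨ cong₂ gap v+G[w+Hc] (cong G (act-∙ h (z , false) t)) ⟩
      gap (t +ᵥ X c) (X s)
        ≡⟨ cong (λ x → ((t +ᵥ X c) −ᵥ x) −ᵥ (t −ᵥ X s)) (+ᵥ-homo X-isLinear t (X c)) ⟩
      ((t +ᵥ X c) −ᵥ (X t +ᵥ X (X c))) −ᵥ (t −ᵥ X s)
        ≡⟨ solve 5 (λ t Xc Xt XXc Xs → ((t ⊕ Xc) ⊖ (Xt ⊕ XXc)) ⊖ (t ⊖ Xs) ⊜ (Xc ⊖ XXc) ⊖ (Xt ⊖ Xs))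
             refl t (X c) (X t) (X (X c)) (X s) ⟩
      (X c −ᵥ X (X c)) −ᵥ (X t −ᵥ X s)
        ≡⟨ X-gap ⟨
      X (gap c s)
        ∎
      where
      open ≡-Reasoning
      s = act (z , false) t
      v+G[w+Hc] : v +ᵥ G (w +ᵥ H c) ≡ t +ᵥ X c
      v+G[w+Hc] = trans (cong (v +ᵥ_) (+ᵥ-homo G-isLinear w (H c))) (sym (+ᵥ-assoc v (G w) (X c)))
      X-gap : X (gap c s) ≡ (X c −ᵥ X (X c)) −ᵥ (X t −ᵥ X s)
      X-gap = trans (−ᵥ-homo X-isLinear (c −ᵥ X c) (t −ᵥ s))
        (cong₂ _−ᵥ_ (−ᵥ-homo X-isLinear c (X c)) (−ᵥ-homo X-isLinear t s))

    defect-τ-reflection : ∀ c z → defect (w +ᵥ H c) (dmul r h (z , true)) ≡ X⁻¹ (defect c (z , true))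
    defect-τ-reflection c z = begin
      gap (w +ᵥ H c) (act (dmul r h (z , true)) t)
        ≡⟨ cong (gap (w +ᵥ H c)) (act-∙ h (z , true) t) ⟩
      ((w +ᵥ H c) −ᵥ X (w +ᵥ H c)) −ᵥ (t −ᵥ H s)
        ≡⟨ cong (λ x → ((w +ᵥ H c) −ᵥ x) −ᵥ (t −ᵥ H s)) X[w+Hc] ⟩
      ((w +ᵥ H c) −ᵥ (-ᵥ G w +ᵥ G c)) −ᵥ ((v +ᵥ G w) −ᵥ H s)
        ≡⟨ solve 7 (λ w Hc Gw Gc v Hs X⁻¹v → ((w ⊕ Hc) ⊖ (⊝ Gw ⊕ Gc)) ⊖ ((v ⊕ Gw) ⊖ Hs) ⊜
                                               ((X⁻¹v ⊕ Hc) ⊖ (v ⊕ Gc)) ⊖ ((X⁻¹v ⊕ ⊝ w) ⊖ Hs))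
             refl w (H c) (G w) (G c) v (H s) (X⁻¹ v) ⟩
      ((X⁻¹ v +ᵥ H c) −ᵥ (v +ᵥ G c)) −ᵥ ((X⁻¹ v +ᵥ -ᵥ w) −ᵥ H s)
        ≡⟨ cong₂ _−ᵥ_ X⁻¹[v+Gc-X[v+Gc]] X⁻¹[t-Gs] ⟨
      X⁻¹ ((v +ᵥ G c) −ᵥ X (v +ᵥ G c)) −ᵥ X⁻¹ (t −ᵥ G s)
        ≡⟨ −ᵥ-homo X⁻¹-isLinear ((v +ᵥ G c) −ᵥ X (v +ᵥ G c)) (t −ᵥ G s) ⟨
      X⁻¹ (gap (v +ᵥ G c) (G s))
        ∎
      where
      open ≡-Reasoning
      s = act (z , true) t
      X[w+Hc] : X (w +ᵥ H c) ≡ -ᵥ G w +ᵥ G c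
      X[w+Hc] = trans (+ᵥ-homo X-isLinear w (H c))
        (cong₂ _+ᵥ_ (trans (cong G H-w) (-ᵥ-homo G-isLinear w)) (cong G (H-involutive c)))
      X⁻¹[v+Gc-X[v+Gc]] : X⁻¹ ((v +ᵥ G c) −ᵥ X (v +ᵥ G c)) ≡ (X⁻¹ v +ᵥ H c) −ᵥ (v +ᵥ G c)
      X⁻¹[v+Gc-X[v+Gc]] = trans (−ᵥ-homo X⁻¹-isLinear (v +ᵥ G c) (X (v +ᵥ G c))) (cong₂ _−ᵥ_
        (trans (+ᵥ-homo X⁻¹-isLinear v (G c)) (cong (X⁻¹ v +ᵥ_) (cong H (G-involutive c))))
        (X⁻¹-X (v +ᵥ G c)))
      X⁻¹[t-Gs] : X⁻¹ (t −ᵥ G s) ≡ (X⁻¹ v +ᵥ -ᵥ w) −ᵥ H s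
      X⁻¹[t-Gs] = trans (−ᵥ-homo X⁻¹-isLinear t (G s)) (cong₂ _−ᵥ_
        (trans (+ᵥ-homo X⁻¹-isLinear v (G w)) (cong (X⁻¹ v +ᵥ_) (trans (cong H (G-involutive w)) H-w)))
        (cong H (G-involutive s)))

    module _ (X≡id : ∀ u → X u ≡ u) where

      H≡G : ∀ u → H u ≡ G u
      H≡G u = trans (sym (G-involutive (H u))) (cong G (X≡id u))

      even odd : V → V
      even c = c +ᵥ G c
      odd  c = c −ᵥ G c

      δ : V
      δ = odd v −ᵥ odd w

      odd-parity : V → Dih r → V
      odd-parity c (z , false) = odd c
      odd-parity c (z , true)  = odd c −ᵥ odd v

      Coordinates : Fin p → Fin p → V → Dih r → Set
      Coordinates x y c k = even c ≡ x · u₂ × odd-parity c k ≡ y · δ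

      private
        odd-v : odd v ≡ odd v −ᵥ 0ₘ · δ
        odd-v = sym (trans (cong (odd v −ᵥ_) (·-zeroˡ δ)) (solve 1 (λ o → o ⊖ ∅ ⊜ o) refl (odd v)))

        G[e+Gc] : ∀ e c → G (e +ᵥ G c) ≡ G e +ᵥ c
        G[e+Gc] e c = trans (+ᵥ-homo G-isLinear e (G c)) (cong (G e +ᵥ_) (G-involutive c))

        -ₘ[x+y]· : ∀ x y → (-ₘ (x +ₘ y)) · δ ≡ -ᵥ (x · δ +ᵥ y · δ)
        -ₘ[x+y]· x y = trans (-ₘ‿· (x +ₘ y) δ) (cong -ᵥ_ (·-distribʳ x y δ))

      coordinates-step : ∀ {e x₀ y₀} → even e ≡ x₀ · u₂ → odd e ≡ odd v −ᵥ y₀ · δ →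
        ∀ l {x y c} k → Coordinates x y c k → Coordinates (x₀ +ₘ x) (-ₘ (y₀ +ₘ y)) (e +ᵥ G c) (dmul r (l , true) k)
      coordinates-step {e} {x₀} {y₀} even-e odd-e l {x} {y} {c} k (even-c , odd-c) = even-step , odd-step k odd-c
        where
        even-step : even (e +ᵥ G c) ≡ (x₀ +ₘ x) · u₂
        even-step = begin
          (e +ᵥ G c) +ᵥ G (e +ᵥ G c)
            ≡⟨ cong ((e +ᵥ G c) +ᵥ_) (G[e+Gc] e c) ⟩
          (e +ᵥ G c) +ᵥ (G e +ᵥ c)
            ≡⟨ solve 4 (λ e Gc Ge c → (e ⊕ Gc) ⊕ (Ge ⊕ c) ⊜ (e ⊕ Ge) ⊕ (c ⊕ Gc)) refl e (G c) (G e) c ⟩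
          even e +ᵥ even c
            ≡⟨ cong₂ _+ᵥ_ even-e even-c ⟩
          x₀ · u₂ +ᵥ x · u₂
            ≡⟨ ·-distribʳ x₀ x u₂ ⟨
          (x₀ +ₘ x) · u₂
            ∎
          where open ≡-Reasoning

        odd-e+Gc : odd (e +ᵥ G c) ≡ (odd v −ᵥ y₀ · δ) −ᵥ odd c
        odd-e+Gc = begin
          (e +ᵥ G c) −ᵥ G (e +ᵥ G c)
            ≡⟨ cong ((e +ᵥ G c) −ᵥ_) (G[e+Gc] e c) ⟩
          (e +ᵥ G c) −ᵥ (G e +ᵥ c)
            ≡⟨ solve 4 (λ e Gc Ge c → (e ⊕ Gc) ⊖ (Ge ⊕ c) ⊜ (e ⊖ Ge) ⊖ (c ⊖ Gc)) refl e (G c) (G e) c ⟩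
          odd e −ᵥ odd c
            ≡⟨ cong (_−ᵥ odd c) odd-e ⟩
          (odd v −ᵥ y₀ · δ) −ᵥ odd c
            ∎
          where open ≡-Reasoning

        odd-step : ∀ k → odd-parity c k ≡ y · δ → odd-parity (e +ᵥ G c) (dmul r (l , true) k) ≡ (-ₘ (y₀ +ₘ y)) · δ
        odd-step (z , false) odd-c = begin
          odd (e +ᵥ G c) −ᵥ odd v
            ≡⟨ cong (_−ᵥ odd v) odd-e+Gc ⟩
          ((odd v −ᵥ y₀ · δ) −ᵥ odd c) −ᵥ odd v
            ≡⟨ cong (λ o → ((odd v −ᵥ y₀ · δ) −ᵥ o) −ᵥ odd v) odd-c ⟩
          ((odd v −ᵥ y₀ · δ) −ᵥ y · δ) −ᵥ odd v
            ≡⟨ solve 3 (λ o a b → ((o ⊖ a) ⊖ b) ⊖ o ⊜ ⊝ (a ⊕ b)) refl (odd v) (y₀ · δ) (y · δ) ⟩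
          -ᵥ (y₀ · δ +ᵥ y · δ)
            ≡⟨ -ₘ[x+y]· y₀ y ⟨
          (-ₘ (y₀ +ₘ y)) · δ
            ∎
          where open ≡-Reasoning
        odd-step (z , true) odd-c = begin
          odd (e +ᵥ G c)
            ≡⟨ odd-e+Gc ⟩
          (odd v −ᵥ y₀ · δ) −ᵥ odd c
            ≡⟨ solve 3 (λ o a oc → (o ⊖ a) ⊖ oc ⊜ ⊝ (a ⊕ (oc ⊖ o))) refl (odd v) (y₀ · δ) (odd c) ⟩
          -ᵥ (y₀ · δ +ᵥ (odd c −ᵥ odd v))
            ≡⟨ cong (λ o → -ᵥ (y₀ · δ +ᵥ o)) odd-c ⟩
          -ᵥ (y₀ · δ +ᵥ y · δ)
            ≡⟨ -ₘ[x+y]· y₀ y ⟨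
          (-ₘ (y₀ +ₘ y)) · δ
            ∎
          where open ≡-Reasoning

      coordinates-ρ : ∀ {x y c} k → Coordinates x y c k → Coordinates (1ₘ +ₘ x) (-ₘ (0ₘ +ₘ y)) (v +ᵥ G c) (dmul r g k)
      coordinates-ρ {x} {y} {c} = coordinates-step {v} {1ₘ} {0ₘ} (sym (·-identityˡ u₂)) odd-v a {x} {y} {c}

      coordinates-ρ⁻¹ : ∀ {x y c} k → Coordinates x y c k →
                        Coordinates (-ₘ 1ₘ +ₘ x) (-ₘ (0ₘ +ₘ y)) (-ᵥ G v +ᵥ G c) (dmul r g k)
      coordinates-ρ⁻¹ {x} {y} {c} = coordinates-step { -ᵥ G v } { -ₘ 1ₘ } {0ₘ} even-Gv (trans odd-Gv odd-v) a {x} {y} {c}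
        where
        open ≡-Reasoning
        even-Gv : even (-ᵥ G v) ≡ (-ₘ 1ₘ) · u₂
        even-Gv = begin
          -ᵥ G v +ᵥ G (-ᵥ G v)    ≡⟨ cong (-ᵥ G v +ᵥ_) G[-Gv] ⟩
          -ᵥ G v +ᵥ -ᵥ v          ≡⟨ solve 2 (λ v Gv → ⊝ Gv ⊕ ⊝ v ⊜ ⊝ (v ⊕ Gv)) refl v (G v) ⟩
          -ᵥ u₂                   ≡⟨ cong -ᵥ_ (·-identityˡ u₂) ⟨
          -ᵥ (1ₘ · u₂)            ≡⟨ -ₘ‿· 1ₘ u₂ ⟨
          (-ₘ 1ₘ) · u₂            ∎
        odd-Gv : odd (-ᵥ G v) ≡ odd v
        odd-Gv = trans (cong (-ᵥ G v −ᵥ_) G[-Gv]) (solve 2 (λ v Gv → ⊝ Gv ⊖ ⊝ v ⊜ v ⊖ Gv) refl v (G v))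

      coordinates-τ : ∀ {x y c} k → Coordinates x y c k → Coordinates (0ₘ +ₘ x) (-ₘ (1ₘ +ₘ y)) (w +ᵥ H c) (dmul r h k)
      coordinates-τ {x} {y} {c} k coords =
        subst (λ e → Coordinates (0ₘ +ₘ x) (-ₘ (1ₘ +ₘ y)) e (dmul r h k)) (cong (w +ᵥ_) (sym (H≡G c)))
          (coordinates-step {w} {0ₘ} {1ₘ} even-w odd-w b {x} {y} {c} k coords)
        where
        even-w : even w ≡ 0ₘ · u₂
        even-w = trans (cong (w +ᵥ_) (trans (sym (H≡G w)) H-w)) (trans (-ᵥ-inverseʳ w) (sym (·-zeroˡ u₂)))
        odd-w : odd w ≡ odd v −ᵥ 1ₘ · δ
        odd-w = trans (solve 2 (λ ov ow → ow ⊜ ov ⊖ (ov ⊖ ow)) refl (odd v) (odd w)) (cong (odd v −ᵥ_) (sym (·-identityˡ δ)))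

module BothReflections
  (p : ℕ) {{_ : NonZero p}} (p-prime : Prime p) (p≢2 : ¬ p ≡ 2) (r : ℕ) {{_ : NonZero r}}
  (n : ℕ) (d : Fin n → ℕ) (ψs : (k : Fin n) → Rep p r (d k)) (irreducible : ∀ k → Irreducible p r (ψs k))
  (vs ws : (k : Fin n) → Vect p (d k)) (a b : Fin r)
  (generates : Generates p r n d ψs (vs , (a , true)) (ws , (b , true)))
  (τ²≡e : ∀ k → proj₁ (spow p r n d ψs (ws , (b , true)) 2) k ≡ vzero p)
  (i j : Fin n) (i≢j : ¬ i ≡ j) (ψᵢ≅ψⱼ : RepIso p r (ψs i) (ψs j))
  where

  open SemidirectProduct p r n d ψs
  open LinearMaps p
  open Vectors p (d i)
  open Representation (ψs i)
  open ReflectionPair (ψs i) a b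
  private
    module Vecⱼ = Vectors p (d j)
    module Repⱼ = Representation (ψs j)
    module Pairⱼ = ReflectionPair (ψs j) a b

  g-h-generate : ∀ (P : Dih r → Set) → P (de r) →
                 (∀ k → P k → P (dmul r g k)) → (∀ k → P k → P (dmul r h k)) → ∀ k → P k
  g-h-generate P P-e P-g P-h = dihedral-induction generates P P-e P-g P-g P-h P-h

  open Irreducibility (irreducible i) g-h-generate

  Q : Vecⱼ.V → V
  Q = apply p (proj₁ (proj₂ ψᵢ≅ψⱼ))

  P : V → Vecⱼ.V
  P = apply p (proj₁ ψᵢ≅ψⱼ)

  Q-P : ∀ u → Q (P u) ≡ u
  Q-P = proj₁ (proj₂ (proj₂ ψᵢ≅ψⱼ))

  Q-isLinear : IsLinear Q
  Q-isLinear = apply-isLinear (proj₁ (proj₂ ψᵢ≅ψⱼ))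

  Q-act : ∀ k u → Q (Repⱼ.act k u) ≡ act k (Q u)
  Q-act k u = begin
    Q (Repⱼ.act k u)               ≡⟨ cong (Q ∘ Repⱼ.act k) (proj₁ (proj₂ (proj₂ (proj₂ ψᵢ≅ψⱼ))) u) ⟨
    Q (Repⱼ.act k (P (Q u)))       ≡⟨ cong Q (proj₂ (proj₂ (proj₂ (proj₂ ψᵢ≅ψⱼ))) k (Q u)) ⟨
    Q (P (act k (Q u)))            ≡⟨ Q-P (act k (Q u)) ⟩
    act k (Q u)                    ∎
    where open ≡-Reasoning

  Q-translate : ∀ k e c → Q (e Vecⱼ.+ᵥ Repⱼ.act k c) ≡ Q e +ᵥ act k (Q c)
  Q-translate k e c = trans (+ᵥ-homo Q-isLinear e (Repⱼ.act k c)) (cong (Q e +ᵥ_) (Q-act k c))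

  Q-translate⁻¹ : ∀ k e c → Q (Vecⱼ.-ᵥ Repⱼ.act k e Vecⱼ.+ᵥ Repⱼ.act k c) ≡ -ᵥ act k (Q e) +ᵥ act k (Q c)
  Q-translate⁻¹ k e c = trans (+ᵥ-homo Q-isLinear (Vecⱼ.-ᵥ Repⱼ.act k e) (Repⱼ.act k c))
    (cong₂ _+ᵥ_ (trans (-ᵥ-homo Q-isLinear (Repⱼ.act k e)) (cong -ᵥ_ (Q-act k e))) (Q-act k c))

  H-wᵢ : H (ws i) ≡ -ᵥ ws i
  H-wᵢ = τ²≡e⇒H-w (ws i) (τ²≡e i)

  H-wⱼ : H (Q (ws j)) ≡ -ᵥ Q (ws j)
  H-wⱼ = trans (sym (Q-act h (ws j))) (trans (cong Q (Pairⱼ.τ²≡e⇒H-w (ws j) (τ²≡e j))) (-ᵥ-homo Q-isLinear (ws j)))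

  -H-w : ∀ {w} → H w ≡ -ᵥ w → -ᵥ H w ≡ w
  -H-w {w} H-w = trans (cong -ᵥ_ H-w) (solve 1 (λ w → ⊝ ⊝ w ⊜ w) refl w)

  module Tᵢ = Translation (vs i) (ws i) H-wᵢ
  module Tⱼ = Translation (Q (vs j)) (Q (ws j)) H-wⱼ

  select : V → Vecⱼ.V → (k : Fin n) → Vect p (d k)
  select y₁ y₂ k with k Fin.≟ i | k Fin.≟ j
  ... | yes refl | _        = y₁
  ... | no _     | yes refl = y₂
  ... | no _     | no _     = vzero p

  select-i : ∀ y₁ y₂ → select y₁ y₂ i ≡ y₁
  select-i y₁ y₂ with i Fin.≟ i | i Fin.≟ j
  ... | yes refl | _ = refl
  ... | no i≢i   | _ = ⊥-elim (i≢i refl)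

  select-j : ∀ y₁ y₂ → select y₁ y₂ j ≡ y₂
  select-j y₁ y₂ with j Fin.≟ i | j Fin.≟ j
  ... | yes j≡i | _        = ⊥-elim (i≢j (sym j≡i))
  ... | no _    | yes refl = refl
  ... | no _    | no j≢j   = ⊥-elim (j≢j refl)

  -- Every element of G is a word in ρ and τ, so an invariant of (c_i , Q c_j , k) stable under
  -- left multiplication by ρ, ρ⁻¹ and τ (note τ⁻¹ = τ) holds at every (y₁ , P y₂ , 1).
  module _ (Inv : V → V → Dih r → Set) (Inv-e : Inv 0ᵥ 0ᵥ (de r))
    (Inv-ρ   : ∀ {c₁ c₂} k → Inv c₁ c₂ k → Inv (vs i +ᵥ G c₁) (Q (vs j) +ᵥ G c₂) (dmul r g k))
    (Inv-ρ⁻¹ : ∀ {c₁ c₂} k → Inv c₁ c₂ k → Inv (-ᵥ G (vs i) +ᵥ G c₁) (-ᵥ G (Q (vs j)) +ᵥ G c₂) (dmul r g k))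
    (Inv-τ   : ∀ {c₁ c₂} k → Inv c₁ c₂ k → Inv (ws i +ᵥ H c₁) (Q (ws j) +ᵥ H c₂) (dmul r h k))
    where

    invariant : ∀ y₁ y₂ → Inv y₁ y₂ (de r)
    invariant y₁ y₂ =
      subst₂ (λ c₁ c₂ → Inv c₁ c₂ (de r)) (select-i y₁ (P y₂)) (trans (cong Q (select-j y₁ (P y₂))) (Q-P y₂))
      (generated-induction generates Inv′ Inv′-resp Inv′-e Inv′-ρ Inv′-ρ⁻¹ Inv′-τ Inv′-τ⁻¹ (select y₁ (P y₂) , de r))
      where
      Inv′ : 𝔾 → Set
      Inv′ (cs , k) = Inv (cs i) (Q (cs j)) k

      Inv′-resp : ∀ {x y} → _≈ˢ_ p r n d ψs x y → Inv′ x → Inv′ y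
      Inv′-resp {x} (cs≡ , k≡) Inv-x =
        subst (Inv _ _) k≡ (subst₂ (λ c₁ c₂ → Inv c₁ c₂ (proj₂ x)) (cs≡ i) (cong Q (cs≡ j)) Inv-x)

      Inv′-e : Inv′ (se p r n d ψs)
      Inv′-e = subst (λ c → Inv 0ᵥ c (de r)) (sym (0ᵥ-homo Q-isLinear)) Inv-e

      Inv′-ρ : ∀ x → Inv′ x → Inv′ ((vs , g) ∙ x)
      Inv′-ρ (cs , k) Inv-x = subst (λ c → Inv (vs i +ᵥ G (cs i)) c (dmul r g k))
        (sym (Q-translate g (vs j) (cs j))) (Inv-ρ k Inv-x)

      Inv′-ρ⁻¹ : ∀ x → Inv′ x → Inv′ ((vs , g) ⁻¹ ∙ x)
      Inv′-ρ⁻¹ (cs , k) Inv-x = subst (λ c → Inv (-ᵥ G (vs i) +ᵥ G (cs i)) c (dmul r g k))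
        (sym (Q-translate⁻¹ g (vs j) (cs j))) (Inv-ρ⁻¹ k Inv-x)

      Inv′-τ : ∀ x → Inv′ x → Inv′ ((ws , h) ∙ x)
      Inv′-τ (cs , k) Inv-x = subst (λ c → Inv (ws i +ᵥ H (cs i)) c (dmul r h k))
        (sym (Q-translate h (ws j) (cs j))) (Inv-τ k Inv-x)

      Inv′-τ⁻¹ : ∀ x → Inv′ x → Inv′ ((ws , h) ⁻¹ ∙ x)
      Inv′-τ⁻¹ (cs , k) Inv-x = subst₂ (λ c₁ c₂ → Inv c₁ c₂ (dmul r h k))
        (cong (_+ᵥ H (cs i)) (sym (-H-w {ws i} H-wᵢ)))
        (sym (trans (Q-translate⁻¹ h (ws j) (cs j)) (cong (_+ᵥ H (Q (cs j))) (-H-w {Q (ws j)} H-wⱼ))))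
        (Inv-τ k Inv-x)

  0-X0≡0 : 0ᵥ −ᵥ X 0ᵥ ≡ 0ᵥ
  0-X0≡0 = trans (cong (0ᵥ −ᵥ_) (0ᵥ-homo X-isLinear)) (-ᵥ-inverseʳ 0ᵥ)

  0+G0≡0 : 0ᵥ +ᵥ G 0ᵥ ≡ 0ᵥ
  0+G0≡0 = trans (+ᵥ-identityˡ (G 0ᵥ)) (0ᵥ-homo G-isLinear)

  0-G0≡0 : 0ᵥ −ᵥ G 0ᵥ ≡ 0ᵥ
  0-G0≡0 = trans (cong (0ᵥ −ᵥ_) (0ᵥ-homo G-isLinear)) (-ᵥ-inverseʳ 0ᵥ)

  -- X has no nonzero fixed vector: then y − X y = 0 for all y, by the invariant below.
  module _ (X-fixed⇒0 : ∀ u → X u ≡ u → u ≡ 0ᵥ) where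

    DefectInvariant : V → V → Dih r → Set
    DefectInvariant c₁ c₂ k = XSpan Tᵢ.u₂ Tⱼ.u₂ (Tᵢ.defect c₁ k) (Tⱼ.defect c₂ k)

    private
      resp : ∀ {y₁ y₂ x₁ x₂} → y₁ ≡ x₁ → y₂ ≡ x₂ →
             XSpan Tᵢ.u₂ Tⱼ.u₂ y₁ y₂ → XSpan Tᵢ.u₂ Tⱼ.u₂ x₁ x₂
      resp = subst₂ (XSpan Tᵢ.u₂ Tⱼ.u₂)

    DefectInvariant-e : DefectInvariant 0ᵥ 0ᵥ (de r)
    DefectInvariant-e = resp (u-u≡defect Tᵢ.u₂ {Tᵢ.defect} Tᵢ.defect-e) (u-u≡defect Tⱼ.u₂ {Tⱼ.defect} Tⱼ.defect-e)
      (XSpan-−ᵥ XSpan-generator XSpan-generator)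
      where
      u-u≡defect : ∀ u {defect : V → Dih r → V} → (∀ c → defect c (de r) ≡ c −ᵥ X c) →
                   u −ᵥ u ≡ defect 0ᵥ (de r)
      u-u≡defect u defect-e = trans (-ᵥ-inverseʳ u) (sym (trans (defect-e 0ᵥ) 0-X0≡0))

    DefectInvariant-ρ : ∀ {c₁ c₂} k → DefectInvariant c₁ c₂ k →
                        DefectInvariant (vs i +ᵥ G c₁) (Q (vs j) +ᵥ G c₂) (dmul r g k)
    DefectInvariant-ρ {c₁} {c₂} (z , false) inv =
      resp (sym (Tᵢ.defect-ρ-rotation c₁ z)) (sym (Tⱼ.defect-ρ-rotation c₂ z)) (XSpan-+ᵥ inv XSpan-1-X)
    DefectInvariant-ρ {c₁} {c₂} (z , true) inv =
      resp (sym (Tᵢ.defect-ρ-reflection c₁ z)) (sym (Tⱼ.defect-ρ-reflection c₂ z)) inv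

    DefectInvariant-ρ⁻¹ : ∀ {c₁ c₂} k → DefectInvariant c₁ c₂ k →
                          DefectInvariant (-ᵥ G (vs i) +ᵥ G c₁) (-ᵥ G (Q (vs j)) +ᵥ G c₂) (dmul r g k)
    DefectInvariant-ρ⁻¹ {c₁} {c₂} (z , false) inv =
      resp (sym (Tᵢ.defect-ρ⁻¹-rotation c₁ z)) (sym (Tⱼ.defect-ρ⁻¹-rotation c₂ z)) inv
    DefectInvariant-ρ⁻¹ {c₁} {c₂} (z , true) inv =
      resp (sym (Tᵢ.defect-ρ⁻¹-reflection c₁ z)) (sym (Tⱼ.defect-ρ⁻¹-reflection c₂ z)) (XSpan-−ᵥ inv XSpan-1-X)

    DefectInvariant-τ : ∀ {c₁ c₂} k → DefectInvariant c₁ c₂ k →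
                        DefectInvariant (ws i +ᵥ H c₁) (Q (ws j) +ᵥ H c₂) (dmul r h k)
    DefectInvariant-τ {c₁} {c₂} (z , false) inv =
      resp (sym (Tᵢ.defect-τ-rotation c₁ z)) (sym (Tⱼ.defect-τ-rotation c₂ z)) (XSpan-X inv)
    DefectInvariant-τ {c₁} {c₂} (z , true) inv =
      resp (sym (Tᵢ.defect-τ-reflection c₁ z)) (sym (Tⱼ.defect-τ-reflection c₂ z)) (XSpan-X⁻¹ inv)

    trivial-when-X-fixed-point-free : ∀ y → y ≡ 0ᵥ
    trivial-when-X-fixed-point-free y =
      X-fixed⇒0 y (sym (x∙y⁻¹≈ε⇒x≈y y (X y)
        (XSpan-separates Tⱼ.G-u₂ (resp refl 0-X0≡0 (span y 0ᵥ)) (resp 0-X0≡0 refl (span 0ᵥ y)))))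
      where
      open import Algebra.Properties.AbelianGroup +ᵥ-abelianGroup using (x∙y⁻¹≈ε⇒x≈y)
      span : ∀ y₁ y₂ → XSpan Tᵢ.u₂ Tⱼ.u₂ (y₁ −ᵥ X y₁) (y₂ −ᵥ X y₂)
      span y₁ y₂ = resp (Tᵢ.defect-e y₁) (Tⱼ.defect-e y₂)
        (invariant DefectInvariant DefectInvariant-e DefectInvariant-ρ DefectInvariant-ρ⁻¹ DefectInvariant-τ y₁ y₂)

  -- X acts trivially: the G-even and G-odd parts of y are both forced to vanish.
  module _ (X≡id : ∀ u → X u ≡ u) where

    open Modular p using (_+ₘ_; -ₘ_; 0ₘ; 1ₘ)

    CoordinateInvariant : V → V → Dih r → Set
    CoordinateInvariant c₁ c₂ k =
      Σ (Fin p) λ x → Σ (Fin p) λ y → Tᵢ.Coordinates X≡id x y c₁ k × Tⱼ.Coordinates X≡id x y c₂ k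

    CoordinateInvariant-e : CoordinateInvariant 0ᵥ 0ᵥ (de r)
    CoordinateInvariant-e = 0ₘ , 0ₘ , (0-multiple Tᵢ.u₂ 0+G0≡0 , 0-multiple (Tᵢ.δ X≡id) 0-G0≡0)
                                    , (0-multiple Tⱼ.u₂ 0+G0≡0 , 0-multiple (Tⱼ.δ X≡id) 0-G0≡0)
      where
      0-multiple : ∀ u {z} → z ≡ 0ᵥ → z ≡ 0ₘ · u
      0-multiple u z≡0 = trans z≡0 (sym (·-zeroˡ u))

    CoordinateInvariant-ρ : ∀ {c₁ c₂} k → CoordinateInvariant c₁ c₂ k →
                            CoordinateInvariant (vs i +ᵥ G c₁) (Q (vs j) +ᵥ G c₂) (dmul r g k)
    CoordinateInvariant-ρ k (x , y , cᵢ , cⱼ) =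
      1ₘ +ₘ x , -ₘ (0ₘ +ₘ y) , Tᵢ.coordinates-ρ X≡id k cᵢ , Tⱼ.coordinates-ρ X≡id k cⱼ

    CoordinateInvariant-ρ⁻¹ : ∀ {c₁ c₂} k → CoordinateInvariant c₁ c₂ k →
                              CoordinateInvariant (-ᵥ G (vs i) +ᵥ G c₁) (-ᵥ G (Q (vs j)) +ᵥ G c₂) (dmul r g k)
    CoordinateInvariant-ρ⁻¹ k (x , y , cᵢ , cⱼ) =
      -ₘ 1ₘ +ₘ x , -ₘ (0ₘ +ₘ y) , Tᵢ.coordinates-ρ⁻¹ X≡id k cᵢ , Tⱼ.coordinates-ρ⁻¹ X≡id k cⱼ

    CoordinateInvariant-τ : ∀ {c₁ c₂} k → CoordinateInvariant c₁ c₂ k →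
                            CoordinateInvariant (ws i +ᵥ H c₁) (Q (ws j) +ᵥ H c₂) (dmul r h k)
    CoordinateInvariant-τ k (x , y , cᵢ , cⱼ) =
      0ₘ +ₘ x , -ₘ (1ₘ +ₘ y) , Tᵢ.coordinates-τ X≡id k cᵢ , Tⱼ.coordinates-τ X≡id k cⱼ

    trivial-when-X-trivial : ∀ y → y ≡ 0ᵥ
    trivial-when-X-trivial y = u+u≡0⇒u≡0 p-prime p≢2 y (begin
      y +ᵥ y                                ≡⟨ solve 2 (λ y Gy → y ⊕ y ⊜ (y ⊕ Gy) ⊕ (y ⊖ Gy)) refl y (G y) ⟩
      (y +ᵥ G y) +ᵥ (y −ᵥ G y)              ≡⟨ cong₂ _+ᵥ_ even≡0 odd≡0 ⟩
      0ᵥ +ᵥ 0ᵥ                              ≡⟨ +ᵥ-identityˡ 0ᵥ ⟩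
      0ᵥ                                    ∎)
      where
      open ≡-Reasoning
      inv : ∀ y₁ y₂ → CoordinateInvariant y₁ y₂ (de r)
      inv = invariant CoordinateInvariant CoordinateInvariant-e
              CoordinateInvariant-ρ CoordinateInvariant-ρ⁻¹ CoordinateInvariant-τ
      even≡0 : y +ᵥ G y ≡ 0ᵥ
      even≡0 = separate (inv y 0ᵥ) (inv 0ᵥ y)
        where
        separate : CoordinateInvariant y 0ᵥ (de r) → CoordinateInvariant 0ᵥ y (de r) → y +ᵥ G y ≡ 0ᵥ
        separate (x , _ , (ey , _) , (e0 , _)) (x′ , _ , _ , (ey′ , _)) =
          multiples-separate p-prime {z = Tᵢ.u₂} {Tⱼ.u₂} {x} {x′} ey (trans (sym 0+G0≡0) e0) ey′
      odd≡0 : y −ᵥ G y ≡ 0ᵥ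
      odd≡0 = separate (inv y 0ᵥ) (inv 0ᵥ y)
        where
        separate : CoordinateInvariant y 0ᵥ (de r) → CoordinateInvariant 0ᵥ y (de r) → y −ᵥ G y ≡ 0ᵥ
        separate (_ , x , (_ , oy) , (_ , o0)) (_ , x′ , _ , (_ , oy′)) =
          multiples-separate p-prime {z = Tᵢ.δ X≡id} {Tⱼ.δ X≡id} {x} {x′} oy (trans (sym 0-G0≡0) o0) oy′

  contradiction : ⊥
  contradiction = proj₂ nonzero-vector
    ([ trivial-when-X-fixed-point-free , trivial-when-X-trivial ]′ X-fixed-dichotomy (proj₁ nonzero-vector))

corollary6p5 : (p : ℕ) {{_ : NonZero p}} → Prime p → ¬ p ≡ 2 →
    (r : ℕ) {{_ : NonZero r}} → 3 ≤ r → ¬ p ∣ r →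
    (n : ℕ) (d : Fin n → ℕ) (ψs : (i : Fin n) → Rep p r (d i)) →
    (∀ i → Irreducible p r (ψs i)) →
    (ρ τ : SD p r n d ψs) →
    RotaryPair p r n d ψs ρ τ → HasOrder p r n d ψs ρ (2 * p) → HasOrder p r n d ψs τ 2 →
    ∀ i j → i <ᶠ j → ¬ RepIso p r (ψs i) (ψs j)
corollary6p5 p p-prime p≢2 r 3≤r p∤r n d ψs irreducible (vs , (a , true)) (ws , (b , true)) (generates , _) _ |τ|≡2 i j i<j =
  BothReflections.contradiction p p-prime p≢2 r n d ψs irreducible vs ws a b generates (proj₁ (proj₁ |τ|≡2)) i j (<⇒≢ i<j)
corollary6p5 p p-prime p≢2 r 3≤r p∤r n d ψs irreducible (vs , (u , false)) (ws , (u′ , false)) (generates , _) _ _ _ _ _ _ =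
  SemidirectProduct.rotations-do-not-generate p r n d ψs vs ws u u′ generates
corollary6p5 p p-prime p≢2 r 3≤r p∤r n d ψs irreducible (vs , (u , false)) (ws , (c , true)) (generates , _) |ρ|≡2p _ _ _ _ _ =
  SemidirectProduct.half-turn-and-reflection-do-not-generate p r n d ψs 3≤r vs ws u c
    (Dihedral.coprime∧r∣2pu⇒u+u≡0 r u (p∤r⇒coprime p-prime p∤r) (SemidirectProduct.rotation-order p r n d ψs |ρ|≡2p))
    generates
corollary6p5 p p-prime p≢2 r 3≤r p∤r n d ψs irreducible (vs , (c , true)) (ws , (u , false)) (generates , _) _ |τ|≡2 _ _ _ _ =
  SemidirectProduct.reflection-and-half-turn-do-not-generate p r n d ψs 3≤r vs ws c u
    (Dihedral.r∣2u⇒u+u≡0 r u (SemidirectProduct.rotation-order p r n d ψs |τ|≡2)) generates
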